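{- Let $d\ge 2$, $\beta\in[0,1]$ and $C_0>0$. There exist constants $C>1$ and $c\in(0,1)$, depending only on $d$ and $C_0$, such that the following holds for every finite field $\mathbb F_q$ of characteristic greater than two. If $E,F\subset\mathbb F_q^d$ satisfy $\max_{x\in\mathbb F_q^d\setminus\{0\}}|E\cap l_x|\le C_0 q^{\beta}$ and $|E||F|\ge C q^{d+\beta}$, then $|\Pi(E,F)|\ge c\,q$.
   Context: $\mathbb F_q$ is a finite field with $q$ elements, characteristic greater than two, $\mathbb F_q^*=\mathbb F_q\setminus\{0\}$. For $x\in\mathbb F_q^d\setminus\{0\}$, $l_x=\{sx: s\in\mathbb F_q^*\}$. For $E,F\subset\mathbb F_q^d$, $\Pi(E,F)=\{x\cdot y: x\in E,\ y\in F\}$ with $x\cdot y=\sum_i x_iy_i$.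
   Formalization: The exponent β ranges over the rationals in [0,1], and the constant C₀ over the positive rationals. -}

module Defs where

open import Data.Nat as ℕ using (ℕ; zero; suc)
open import Data.Integer using (+_)
open import Data.Bool using (Bool; true; false; _∧_; not)
open import Data.Fin as Fin using (Fin)
open import Data.Fin.Properties using () renaming (_≟_ to _≟ᶠ_)
open import Data.Vec as Vec using (Vec; []; _∷_)
open import Data.Vec.Properties using (≡-dec)
open import Data.List as List using (List; []; _∷_; allFin; concatMap)
open import Data.Bool.ListAction using (any)
open import Data.Product using (∃)
open import Data.Rational using (ℚ; 1ℚ; _*_; _/_)
open import Relation.Nullary using (¬_; does)
open import Relation.Binary.PropositionalEquality using (_≡_)
open import Algebra.Structures using (IsCommutativeRing)

-- A finite field with q elements, realised (up to isomorphism) on the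
-- carrier Fin q with propositional equality.
record FiniteField (q : ℕ) : Set where
  field
    _+F_ : Fin q → Fin q → Fin q
    _*F_ : Fin q → Fin q → Fin q
    -F_  : Fin q → Fin q
    0F   : Fin q
    1F   : Fin q
    isCommutativeRing : IsCommutativeRing _≡_ _+F_ _*F_ -F_ 0F 1F
    0≢1     : ¬ (0F ≡ 1F)
    inverse : ∀ x → ¬ (x ≡ 0F) → ∃ λ y → x *F y ≡ 1F

  -- characteristic greater than two (char is 0 or prime; it is not 2)
  CharGt2 : Set
  CharGt2 = ¬ ((1F +F 1F) ≡ 0F)

open FiniteField public

ℕ→ℚ : ℕ → ℚ
ℕ→ℚ n = + n / 1

_^ℚ_ : ℚ → ℕ → ℚ
x ^ℚ zero  = 1ℚ
x ^ℚ suc n = x * (x ^ℚ n)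

module _ {q : ℕ} (𝔽 : FiniteField q) where

  Pt : ℕ → Set
  Pt d = Vec (Fin q) d

  allPts : (d : ℕ) → List (Pt d)
  allPts zero    = [] ∷ []
  allPts (suc d) = concatMap (λ a → List.map (a ∷_) (allPts d)) (allFin q)

  zeroPt : (d : ℕ) → Pt d
  zeroPt d = Vec.replicate d (0F 𝔽)

  dot : {d : ℕ} → Pt d → Pt d → Fin q
  dot [] [] = 0F 𝔽
  dot (x ∷ xs) (y ∷ ys) = _+F_ 𝔽 (_*F_ 𝔽 x y) (dot xs ys)

  scale : {d : ℕ} → Fin q → Pt d → Pt d
  scale s = Vec.map (_*F_ 𝔽 s)

  card : {d : ℕ} → (Pt d → Bool) → ℕ
  card {d} E = List.length (List.filter (λ x → Data.Bool.T? (E x)) (allPts d))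
    where import Data.Bool

  -- membership in l_x = { s x : s ∈ F_q^* }
  inLine : {d : ℕ} → Pt d → Pt d → Bool
  inLine x y = any (λ s → not (does (s ≟ᶠ 0F 𝔽)) ∧ does (≡-dec _≟ᶠ_ (scale s x) y)) (allFin q)

  _∩line_ : {d : ℕ} → (Pt d → Bool) → Pt d → (Pt d → Bool)
  (E ∩line x) y = E y ∧ inLine x y

  cardΠ : {d : ℕ} → (Pt d → Bool) → (Pt d → Bool) → ℕ
  cardΠ {d} E F = List.length (List.filter (λ t → Data.Bool.T? (inΠ t)) (allFin q))
    where
      import Data.Bool
      inΠ : Fin q → Bool
      inΠ t = any (λ x → any (λ y → E x ∧ F y ∧ does (dot x y ≟ᶠ t)) (allPts d)) (allPts d)

module Submission where

-- For x ∈ F_q^d let r(x, t) = |{y ∈ F : x · y = t}| and ν(t) = ∑_{x ∈ E∖0} r(x, t). Then ∑_t ν(t) = |E∖0| |F| and ν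
-- vanishes off Π(E, F), so Cauchy–Schwarz twice gives
--   (|E∖0| |F|)² ≤ |Π(E, F)| ∑_t ν(t)² ≤ |Π(E, F)| |E∖0| ∑_{x ∈ E∖0} T(x),
-- where T(x) = ∑_t r(x, t)² counts pairs of F with equal dot product against x, and q T(x) = |F|² + U(x) with U ≥ 0.
-- Since U is constant on punctured lines through 0, every x ∈ E∖0 spreads U(x) over its q - 1 multiples, and the
-- bound on |E ∩ l_z| turns this into 4 q^d (q - 1) ∑_{E∖0} U ≤ |E| |F| ∑_{z ≠ 0} U(z). Counting ∑_z T(z) with
-- hyperplanes gives ∑_{z ≠ 0} U(z) ≤ (q - 1) |F| q^d, hence 4 ∑_{E∖0} U ≤ |E| |F|², and together with
-- |E| |F| ≥ 4 q^d this yields q ≤ 2 |Π(E, F)|. With C = 4 (C₀ + 1), the hypotheses (raised to the power b, where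
-- β = a / b) imply |E| |F| ≥ 4 q^d and |E| |F| ≥ 4 |E ∩ l_z| q^d.

open import Defs
open import Data.Nat using (ℕ; suc)
open import Data.Bool using (Bool)

module FiniteSums where
  open import Data.Nat using (ℕ; zero; suc; _+_; _*_; _≤_; _∸_; z≤n; s≤s)
  open import Data.Nat.Properties renaming (_≟_ to _≟ℕ_)
  open import Data.Nat.Tactic.RingSolver using (solve-∀)
  open import Data.Bool using (Bool; true; false; _∧_)
  import Data.Bool as Bool
  open import Data.List using (List; []; _∷_; _++_; map; concatMap; length; filter)
  open import Data.Bool.ListAction using (any)
  open import Data.Product using (Σ; _,_)
  open import Data.Sum using (inj₁; inj₂)
  open import Data.Empty using (⊥-elim)
  open import Relation.Nullary using (¬_; Dec; yes; no; does; ¬?)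
  open import Relation.Binary.PropositionalEquality
  open import Relation.Binary.Definitions using (DecidableEquality)
  open import Function using (_∘_; id)
  open import Data.Fin as Fin using (Fin)
  open import Data.Fin.Properties using () renaming (_≟_ to _≟ᶠ_; suc-injective to Fin-suc-injective)
  open import Data.List using (allFin)
  open import Data.List.Properties using (map-tabulate)
  open import Algebra.Properties.CommutativeSemigroup +-commutativeSemigroup
    using () renaming (interchange to +-interchange)

  χ : Bool → ℕ
  χ true  = 1
  χ false = 0

  ⟦_⟧ : {P : Set} → Dec P → ℕ
  ⟦ d ⟧ = χ (does d)

  χ-idem : ∀ b → χ b * χ b ≡ χ b
  χ-idem true  = refl
  χ-idem false = refl

  χ-≤1 : ∀ b → χ b ≤ 1
  χ-≤1 true  = s≤s z≤n
  χ-≤1 false = z≤n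

  χ-∧ : ∀ a b → χ (a ∧ b) ≡ χ a * χ b
  χ-∧ true  b = sym (+-identityʳ (χ b))
  χ-∧ false b = refl

  module _ {P : Set} where

    ⟦⟧-yes : (d : Dec P) → P → ⟦ d ⟧ ≡ 1
    ⟦⟧-yes (yes _) p = refl
    ⟦⟧-yes (no ¬p) p = ⊥-elim (¬p p)

    ⟦⟧-no : (d : Dec P) → ¬ P → ⟦ d ⟧ ≡ 0
    ⟦⟧-no (yes p) ¬p = ⊥-elim (¬p p)
    ⟦⟧-no (no _)  ¬p = refl

    ⟦⟧-≤1 : (d : Dec P) → ⟦ d ⟧ ≤ 1
    ⟦⟧-≤1 d = χ-≤1 (does d)

    ⟦⟧-idem : (d : Dec P) → ⟦ d ⟧ * ⟦ d ⟧ ≡ ⟦ d ⟧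
    ⟦⟧-idem d = χ-idem (does d)

    ⟦⟧≢0⇒holds : (d : Dec P) → ¬ ⟦ d ⟧ ≡ 0 → P
    ⟦⟧≢0⇒holds (yes p) _ = p
    ⟦⟧≢0⇒holds (no _)  h = ⊥-elim (h refl)

    ⟦¬⟧+⟦⟧≡1 : (d : Dec P) → ⟦ ¬? d ⟧ + ⟦ d ⟧ ≡ 1
    ⟦¬⟧+⟦⟧≡1 (yes _) = refl
    ⟦¬⟧+⟦⟧≡1 (no _)  = refl

  ⟦⟧-cong : ∀ {P Q : Set} (d : Dec P) (e : Dec Q) → (P → Q) → (Q → P) → ⟦ d ⟧ ≡ ⟦ e ⟧
  ⟦⟧-cong (yes p) (yes q) f g = refl
  ⟦⟧-cong (yes p) (no ¬q) f g = ⊥-elim (¬q (f p))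
  ⟦⟧-cong (no ¬p) (yes q) f g = ⊥-elim (¬p (g q))
  ⟦⟧-cong (no ¬p) (no ¬q) f g = refl

  ⟦⟧-× : ∀ {P A B : Set} (d : Dec P) (a : Dec A) (b : Dec B) →
         (P → A) → (P → B) → (A → B → P) → ⟦ d ⟧ ≡ ⟦ a ⟧ * ⟦ b ⟧
  ⟦⟧-× d (yes a) (yes b) f g h = ⟦⟧-yes d (h a b)
  ⟦⟧-× d (yes a) (no ¬b) f g h = ⟦⟧-no d (¬b ∘ g)
  ⟦⟧-× d (no ¬a) b       f g h = ⟦⟧-no d (¬a ∘ f)

  module _ {A : Set} where

    ∑ : List A → (A → ℕ) → ℕ
    ∑ []       g = 0
    ∑ (x ∷ xs) g = g x + ∑ xs g

    ∑-cong : ∀ xs {g h : A → ℕ} → (∀ x → g x ≡ h x) → ∑ xs g ≡ ∑ xs h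
    ∑-cong []       e = refl
    ∑-cong (x ∷ xs) e = cong₂ _+_ (e x) (∑-cong xs e)

    ∑-mono : ∀ xs {g h : A → ℕ} → (∀ x → g x ≤ h x) → ∑ xs g ≤ ∑ xs h
    ∑-mono []       e = z≤n
    ∑-mono (x ∷ xs) e = +-mono-≤ (e x) (∑-mono xs e)

    ∑-distrib-+ : ∀ xs (g h : A → ℕ) → ∑ xs (λ x → g x + h x) ≡ ∑ xs g + ∑ xs h
    ∑-distrib-+ []       g h = refl
    ∑-distrib-+ (x ∷ xs) g h rewrite ∑-distrib-+ xs g h = +-interchange (g x) (h x) _ _

    ∑-*ˡ : ∀ xs c (g : A → ℕ) → ∑ xs (λ x → c * g x) ≡ c * ∑ xs g
    ∑-*ˡ []       c g = sym (*-zeroʳ c)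
    ∑-*ˡ (x ∷ xs) c g rewrite ∑-*ˡ xs c g = sym (*-distribˡ-+ c (g x) (∑ xs g))

    ∑-*ʳ : ∀ xs c (g : A → ℕ) → ∑ xs (λ x → g x * c) ≡ ∑ xs g * c
    ∑-*ʳ xs c g = trans (∑-cong xs (λ x → *-comm (g x) c)) (trans (∑-*ˡ xs c g) (*-comm c _))

    ∑-zero : ∀ xs → ∑ xs (λ _ → 0) ≡ 0
    ∑-zero []       = refl
    ∑-zero (x ∷ xs) = ∑-zero xs

    ∑-const : ∀ xs c → ∑ xs (λ _ → c) ≡ length xs * c
    ∑-const []       c = refl
    ∑-const (x ∷ xs) c = cong (c +_) (∑-const xs c)

    ∑-++ : ∀ xs ys (g : A → ℕ) → ∑ (xs ++ ys) g ≡ ∑ xs g + ∑ ys g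
    ∑-++ []       ys g = refl
    ∑-++ (x ∷ xs) ys g rewrite ∑-++ xs ys g = sym (+-assoc (g x) _ _)

    ∑≢0⇒witness : ∀ xs (g : A → ℕ) → ¬ ∑ xs g ≡ 0 → Σ A (λ x → ¬ g x ≡ 0)
    ∑≢0⇒witness []       g h = ⊥-elim (h refl)
    ∑≢0⇒witness (x ∷ xs) g h with g x ≟ℕ 0
    ... | no gx≢0 = x , gx≢0
    ... | yes gx≡0 = ∑≢0⇒witness xs g (λ e → h (cong₂ _+_ gx≡0 e))

    length-filter : ∀ xs (p : A → Bool) → length (filter (λ x → Bool.T? (p x)) xs) ≡ ∑ xs (χ ∘ p)
    length-filter []       p = refl
    length-filter (x ∷ xs) p with p x
    ... | true  = cong suc (length-filter xs p)
    ... | false = length-filter xs p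

    ∑-any-false : ∀ xs (p : A → Bool) (g : A → ℕ) → (∀ x → p x ≡ false → g x ≡ 0) →
                  any p xs ≡ false → ∑ xs g ≡ 0
    ∑-any-false []       p g g0 h = refl
    ∑-any-false (x ∷ xs) p g g0 h with p x in px
    ... | false = cong₂ _+_ (g0 x px) (∑-any-false xs p g g0 h)

  module _ {A B : Set} where

    ∑-swap : ∀ (xs : List A) (ys : List B) (g : A → B → ℕ) →
             ∑ xs (λ x → ∑ ys (g x)) ≡ ∑ ys (λ y → ∑ xs (λ x → g x y))
    ∑-swap []       ys g = sym (∑-zero ys)
    ∑-swap (x ∷ xs) ys g rewrite ∑-swap xs ys g = sym (∑-distrib-+ ys (g x) _)

    ∑-map : ∀ (f : A → B) xs (g : B → ℕ) → ∑ (map f xs) g ≡ ∑ xs (g ∘ f)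
    ∑-map f []       g = refl
    ∑-map f (x ∷ xs) g = cong (g (f x) +_) (∑-map f xs g)

    ∑-concatMap : ∀ (f : A → List B) xs (g : B → ℕ) → ∑ (concatMap f xs) g ≡ ∑ xs (λ x → ∑ (f x) g)
    ∑-concatMap f []       g = refl
    ∑-concatMap f (x ∷ xs) g = trans (∑-++ (f x) (concatMap f xs) g) (cong (∑ (f x) g +_) (∑-concatMap f xs g))

  private
    sq-≤⇒≤ : ∀ {x y} → x * x ≤ y * y → x ≤ y
    sq-≤⇒≤ {x} {y} h with x ≤? y
    ... | yes x≤y = x≤y
    ... | no x≰y = ⊥-elim (<⇒≱ (*-mono-< y<x y<x) h)
      where y<x = ≰⇒> x≰y

    am-gm-ordered : ∀ {u v} → u ≤ v → 4 * (u * v) ≤ (u + v) * (u + v)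
    am-gm-ordered {u} {v} u≤v =
      subst (λ w → 4 * (u * w) ≤ (u + w) * (u + w)) (m+[n∸m]≡n u≤v)
        (subst (4 * (u * (u + t)) ≤_) (expand u t) (m≤m+n _ (t * t)))
      where
      t = v ∸ u
      expand : ∀ u t → 4 * (u * (u + t)) + t * t ≡ (u + (u + t)) * (u + (u + t))
      expand = solve-∀

    am-gm : ∀ u v → 4 * (u * v) ≤ (u + v) * (u + v)
    am-gm u v with ≤-total u v
    ... | inj₁ u≤v = am-gm-ordered u≤v
    ... | inj₂ v≤u = subst₂ _≤_ (cong (4 *_) (*-comm v u)) (cong (λ w → w * w) (+-comm v u)) (am-gm-ordered v≤u)

    -- The inductive step of Cauchy–Schwarz: 2abS ≤ a²B + Ab² follows from S² ≤ AB by AM–GM.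
    cauchy-schwarz-step : ∀ a b S A B → S * S ≤ A * B →
      (a * b + S) * (a * b + S) ≤ (a * a + A) * (b * b + B)
    cauchy-schwarz-step a b S A B h =
      subst₂ _≤_ (sym (expandˡ a b S)) (sym (expandʳ a b A B))
        (+-monoʳ-≤ (a * a * (b * b)) (+-mono-≤ cross h))
      where
      open ≤-Reasoning
      expandˡ : ∀ a b S → (a * b + S) * (a * b + S) ≡ a * a * (b * b) + (2 * (a * b * S) + S * S)
      expandˡ = solve-∀
      expandʳ : ∀ a b A B → (a * a + A) * (b * b + B) ≡ a * a * (b * b) + ((a * a * B + A * (b * b)) + A * B)
      expandʳ = solve-∀
      square : ∀ a b S → (2 * (a * b * S)) * (2 * (a * b * S)) ≡ 4 * ((a * b) * (a * b) * (S * S))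
      square = solve-∀
      regroup : ∀ a b A B → 4 * ((a * b) * (a * b) * (A * B)) ≡ 4 * ((a * a * B) * (A * (b * b)))
      regroup = solve-∀
      cross : 2 * (a * b * S) ≤ a * a * B + A * (b * b)
      cross = sq-≤⇒≤ (begin
        (2 * (a * b * S)) * (2 * (a * b * S))  ≡⟨ square a b S ⟩
        4 * ((a * b) * (a * b) * (S * S))      ≤⟨ *-monoʳ-≤ 4 (*-monoʳ-≤ ((a * b) * (a * b)) h) ⟩
        4 * ((a * b) * (a * b) * (A * B))      ≡⟨ regroup a b A B ⟩
        4 * ((a * a * B) * (A * (b * b)))      ≤⟨ am-gm (a * a * B) (A * (b * b)) ⟩
        (a * a * B + A * (b * b)) * (a * a * B + A * (b * b)) ∎)

  cauchy-schwarz : ∀ {A : Set} xs (a b : A → ℕ) →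
    ∑ xs (λ x → a x * b x) * ∑ xs (λ x → a x * b x) ≤ ∑ xs (λ x → a x * a x) * ∑ xs (λ x → b x * b x)
  cauchy-schwarz []       a b = z≤n
  cauchy-schwarz (x ∷ xs) a b = cauchy-schwarz-step (a x) (b x) _ _ _ (cauchy-schwarz xs a b)

  module Enumeration {A : Set} (_≟_ : DecidableEquality A) (xs : List A)
                     (enumerates : ∀ u → ∑ xs (λ x → ⟦ x ≟ u ⟧) ≡ 1) where

    ⟦≟⟧-sym : ∀ x u → ⟦ u ≟ x ⟧ ≡ ⟦ x ≟ u ⟧
    ⟦≟⟧-sym x u = ⟦⟧-cong (u ≟ x) (x ≟ u) sym sym

    enumerates′ : ∀ u → ∑ xs (λ x → ⟦ u ≟ x ⟧) ≡ 1
    enumerates′ u = trans (∑-cong xs (λ x → ⟦≟⟧-sym x u)) (enumerates u)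

    ∑-delta : ∀ u (g : A → ℕ) → ∑ xs (λ x → ⟦ x ≟ u ⟧ * g x) ≡ g u
    ∑-delta u g = begin
      ∑ xs (λ x → ⟦ x ≟ u ⟧ * g x)  ≡⟨ ∑-cong xs evaluate ⟩
      ∑ xs (λ x → ⟦ x ≟ u ⟧ * g u)  ≡⟨ ∑-*ʳ xs (g u) (λ x → ⟦ x ≟ u ⟧) ⟩
      ∑ xs (λ x → ⟦ x ≟ u ⟧) * g u  ≡⟨ cong (_* g u) (enumerates u) ⟩
      1 * g u                        ≡⟨ *-identityˡ (g u) ⟩
      g u                            ∎
      where
      open ≡-Reasoning
      evaluate : ∀ x → ⟦ x ≟ u ⟧ * g x ≡ ⟦ x ≟ u ⟧ * g u
      evaluate x with x ≟ u
      ... | yes refl = refl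
      ... | no _     = refl

    ∑-delta′ : ∀ u (g : A → ℕ) → ∑ xs (λ x → ⟦ u ≟ x ⟧ * g x) ≡ g u
    ∑-delta′ u g = trans (∑-cong xs (λ x → cong (_* g x) (⟦≟⟧-sym x u))) (∑-delta u g)

    ∑-≢+1 : ∀ u → ∑ xs (λ x → ⟦ ¬? (x ≟ u) ⟧) + 1 ≡ ∑ xs (λ _ → 1)
    ∑-≢+1 u = begin
      ∑ xs (λ x → ⟦ ¬? (x ≟ u) ⟧) + 1                         ≡⟨ cong (∑ xs (λ x → ⟦ ¬? (x ≟ u) ⟧) +_) (sym (enumerates u)) ⟩
      ∑ xs (λ x → ⟦ ¬? (x ≟ u) ⟧) + ∑ xs (λ x → ⟦ x ≟ u ⟧)  ≡⟨ sym (∑-distrib-+ xs _ _) ⟩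
      ∑ xs (λ x → ⟦ ¬? (x ≟ u) ⟧ + ⟦ x ≟ u ⟧)                ≡⟨ ∑-cong xs (λ x → ⟦¬⟧+⟦⟧≡1 (x ≟ u)) ⟩
      ∑ xs (λ _ → 1)                                          ∎
      where open ≡-Reasoning

    ∑-≤1 : ∀ (g : A → ℕ) → (∀ x → g x ≤ 1) → (∀ x y → ¬ g x ≡ 0 → ¬ g y ≡ 0 → x ≡ y) → ∑ xs g ≤ 1
    ∑-≤1 g g≤1 unique with ∑ xs g ≟ℕ 0
    ... | yes ∑≡0 = ≤-trans (≤-reflexive ∑≡0) z≤n
    ... | no ∑≢0 with ∑≢0⇒witness xs g ∑≢0
    ... | x₀ , gx₀≢0 = subst (∑ xs g ≤_) (enumerates x₀) (∑-mono xs g≤δ)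
      where
      g≤δ : ∀ x → g x ≤ ⟦ x ≟ x₀ ⟧
      g≤δ x with g x ≟ℕ 0
      ... | yes gx≡0 = ≤-trans (≤-reflexive gx≡0) z≤n
      ... | no gx≢0 = subst (g x ≤_) (sym (⟦⟧-yes (x ≟ x₀) (unique x x₀ gx≢0 gx₀≢0))) (g≤1 x)

  ∑-allFin-suc : ∀ n (g : Fin (suc n) → ℕ) → ∑ (allFin (suc n)) g ≡ g Fin.zero + ∑ (allFin n) (g ∘ Fin.suc)
  ∑-allFin-suc n g = cong (g Fin.zero +_) (trans (cong (λ xs → ∑ xs g) (sym (map-tabulate id Fin.suc)))
                                                 (∑-map Fin.suc (allFin n) g))

  allFin-enumerates : ∀ n (u : Fin n) → ∑ (allFin n) (λ t → ⟦ t ≟ᶠ u ⟧) ≡ 1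
  allFin-enumerates (suc n) Fin.zero = begin
    ∑ (allFin (suc n)) (λ t → ⟦ t ≟ᶠ Fin.zero ⟧)  ≡⟨ ∑-allFin-suc n (λ t → ⟦ t ≟ᶠ Fin.zero ⟧) ⟩
    1 + ∑ (allFin n) (λ t → ⟦ Fin.suc t ≟ᶠ Fin.zero ⟧)
      ≡⟨ cong suc (trans (∑-cong (allFin n) (λ t → ⟦⟧-no (Fin.suc t ≟ᶠ Fin.zero) λ ())) (∑-zero (allFin n))) ⟩
    1 ∎
    where open ≡-Reasoning
  allFin-enumerates (suc n) (Fin.suc u) = begin
    ∑ (allFin (suc n)) (λ t → ⟦ t ≟ᶠ Fin.suc u ⟧)      ≡⟨ ∑-allFin-suc n (λ t → ⟦ t ≟ᶠ Fin.suc u ⟧) ⟩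
    ∑ (allFin n) (λ t → ⟦ Fin.suc t ≟ᶠ Fin.suc u ⟧)  ≡⟨ ∑-cong (allFin n) (λ t → ⟦⟧-cong (Fin.suc t ≟ᶠ Fin.suc u) (t ≟ᶠ u) Fin-suc-injective (cong Fin.suc)) ⟩
    ∑ (allFin n) (λ t → ⟦ t ≟ᶠ u ⟧)                  ≡⟨ allFin-enumerates n u ⟩
    1 ∎
    where open ≡-Reasoning

module FieldAlgebra {q : ℕ} (𝔽 : FiniteField q) where
  open import Level using (0ℓ)
  open import Data.Nat using (ℕ; zero; suc; _≤_; z≤n; s≤s)
  open import Data.Fin as Fin using (Fin)
  open import Data.Fin.Properties using (_≟_)
  open import Data.Vec as Vec using ([]; _∷_)
  open import Data.Product using (proj₁; proj₂)
  open import Data.Empty using (⊥-elim)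
  open import Relation.Nullary using (¬_; yes; no)
  open import Relation.Binary.PropositionalEquality
  open import Algebra.Bundles using (CommutativeRing)
  import Algebra.Properties.Ring as RingProperties
  import Algebra.Properties.CommutativeSemigroup as CommutativeSemigroupProperties

  commutativeRing : CommutativeRing 0ℓ 0ℓ
  commutativeRing = record { isCommutativeRing = isCommutativeRing 𝔽 }

  open CommutativeRing commutativeRing public using (_+_; _*_; -_; _-_)
  open CommutativeRing commutativeRing
    using (*-comm; *-assoc; *-identityˡ; *-identityʳ; zeroˡ; zeroʳ; +-identityˡ; +-identityʳ; distribˡ)
  open RingProperties (CommutativeRing.ring commutativeRing) public
    using (y≈x\\z; \\-leftDividesˡ; x∙y⁻¹≈ε⇒x≈y; x≈y⇒x∙y⁻¹≈ε)
  open RingProperties (CommutativeRing.ring commutativeRing) using (x[y-z]≈xy-xz; -‿+-comm)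

  𝟘 𝟙 : Fin q
  𝟘 = 0F 𝔽
  𝟙 = 1F 𝔽

  2≤q : 2 ≤ q
  2≤q = distinct⇒2≤ 𝟘 𝟙 (0≢1 𝔽)
    where
    distinct⇒2≤ : ∀ {n} (i j : Fin n) → ¬ i ≡ j → 2 ≤ n
    distinct⇒2≤ {suc zero}    Fin.zero Fin.zero i≢j = ⊥-elim (i≢j refl)
    distinct⇒2≤ {suc (suc n)} _        _        _   = s≤s (s≤s z≤n)

  inv : (w : Fin q) → ¬ w ≡ 𝟘 → Fin q
  inv w w≢0 = proj₁ (inverse 𝔽 w w≢0)

  *-inverseʳ : ∀ w (w≢0 : ¬ w ≡ 𝟘) → w * inv w w≢0 ≡ 𝟙
  *-inverseʳ w w≢0 = proj₂ (inverse 𝔽 w w≢0)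

  *-inverseˡ : ∀ w (w≢0 : ¬ w ≡ 𝟘) → inv w w≢0 * w ≡ 𝟙
  *-inverseˡ w w≢0 = trans (*-comm _ w) (*-inverseʳ w w≢0)

  inv≢0 : ∀ w (w≢0 : ¬ w ≡ 𝟘) → ¬ inv w w≢0 ≡ 𝟘
  inv≢0 w w≢0 inv≡0 = 0≢1 𝔽 (begin
    𝟘              ≡⟨ sym (zeroʳ w) ⟩
    w * 𝟘          ≡⟨ cong (w *_) (sym inv≡0) ⟩
    w * inv w w≢0  ≡⟨ *-inverseʳ w w≢0 ⟩
    𝟙              ∎)
    where open ≡-Reasoning

  x*w≡c⇒x≡c*w⁻¹ : ∀ x w c (w≢0 : ¬ w ≡ 𝟘) → x * w ≡ c → x ≡ c * inv w w≢0
  x*w≡c⇒x≡c*w⁻¹ x w c w≢0 x*w≡c = begin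
    x                          ≡⟨ sym (*-identityʳ x) ⟩
    x * 𝟙                      ≡⟨ cong (x *_) (sym (*-inverseʳ w w≢0)) ⟩
    x * (w * inv w w≢0)        ≡⟨ sym (*-assoc x w _) ⟩
    x * w * inv w w≢0          ≡⟨ cong (_* inv w w≢0) x*w≡c ⟩
    c * inv w w≢0              ∎
    where open ≡-Reasoning

  x≡c*w⁻¹⇒x*w≡c : ∀ x w c (w≢0 : ¬ w ≡ 𝟘) → x ≡ c * inv w w≢0 → x * w ≡ c
  x≡c*w⁻¹⇒x*w≡c x w c w≢0 refl = begin
    c * inv w w≢0 * w    ≡⟨ *-assoc c _ w ⟩
    c * (inv w w≢0 * w)  ≡⟨ cong (c *_) (*-inverseˡ w w≢0) ⟩
    c * 𝟙                ≡⟨ *-identityʳ c ⟩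
    c                    ∎
    where open ≡-Reasoning

  *-cancelʳ-≢0 : ∀ s t w → ¬ w ≡ 𝟘 → s * w ≡ t * w → s ≡ t
  *-cancelʳ-≢0 s t w w≢0 sw≡tw =
    trans (x*w≡c⇒x≡c*w⁻¹ s w (t * w) w≢0 sw≡tw) (sym (x*w≡c⇒x≡c*w⁻¹ t w (t * w) w≢0 refl))

  *-cancelˡ-≢0 : ∀ w s t → ¬ w ≡ 𝟘 → w * s ≡ w * t → s ≡ t
  *-cancelˡ-≢0 w s t w≢0 ws≡wt = *-cancelʳ-≢0 s t w w≢0 (trans (*-comm s w) (trans ws≡wt (*-comm w t)))

  *-zero-≢0 : ∀ w s → ¬ w ≡ 𝟘 → w * s ≡ 𝟘 → s ≡ 𝟘
  *-zero-≢0 w s w≢0 ws≡0 = *-cancelˡ-≢0 w s 𝟘 w≢0 (trans ws≡0 (sym (zeroʳ w)))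

  dot′ : ∀ {d} → Pt 𝔽 d → Pt 𝔽 d → Fin q
  dot′ = dot 𝔽

  scale′ : ∀ {d} → Fin q → Pt 𝔽 d → Pt 𝔽 d
  scale′ = scale 𝔽

  0ᵥ : ∀ d → Pt 𝔽 d
  0ᵥ = zeroPt 𝔽

  _-ᵥ_ : ∀ {d} → Pt 𝔽 d → Pt 𝔽 d → Pt 𝔽 d
  _-ᵥ_ = Vec.zipWith _-_

  dot-scaleˡ : ∀ {d} s (x y : Pt 𝔽 d) → dot′ (scale′ s x) y ≡ s * dot′ x y
  dot-scaleˡ s []       []       = sym (zeroʳ s)
  dot-scaleˡ s (x ∷ xs) (y ∷ ys) = begin
    s * x * y + dot′ (scale′ s xs) ys  ≡⟨ cong₂ _+_ (*-assoc s x y) (dot-scaleˡ s xs ys) ⟩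
    s * (x * y) + s * dot′ xs ys       ≡⟨ sym (distribˡ s _ _) ⟩
    s * (x * y + dot′ xs ys)           ∎
    where open ≡-Reasoning

  dot-zeroˡ : ∀ {d} (y : Pt 𝔽 d) → dot′ (0ᵥ d) y ≡ 𝟘
  dot-zeroˡ []       = refl
  dot-zeroˡ (y ∷ ys) = trans (cong₂ _+_ (zeroˡ y) (dot-zeroˡ ys)) (+-identityˡ 𝟘)

  dot-zeroʳ : ∀ {d} (y : Pt 𝔽 d) → dot′ y (0ᵥ d) ≡ 𝟘
  dot-zeroʳ []       = refl
  dot-zeroʳ (y ∷ ys) = trans (cong₂ _+_ (zeroʳ y) (dot-zeroʳ ys)) (+-identityˡ 𝟘)

  dot-∷-zeroʳ : ∀ {d} a w (zs : Pt 𝔽 d) → dot′ (a ∷ zs) (w ∷ 0ᵥ d) ≡ a * w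
  dot-∷-zeroʳ a w zs = trans (cong (a * w +_) (dot-zeroʳ zs)) (+-identityʳ (a * w))

  dot--ᵥ : ∀ {d} (z y y′ : Pt 𝔽 d) → dot′ z (y -ᵥ y′) ≡ dot′ z y - dot′ z y′
  dot--ᵥ []       []       []         = sym (x≈y⇒x∙y⁻¹≈ε refl)
  dot--ᵥ (z ∷ zs) (y ∷ ys) (y′ ∷ ys′) = begin
    z * (y - y′) + dot′ zs (ys -ᵥ ys′)                  ≡⟨ cong₂ _+_ (x[y-z]≈xy-xz z y y′) (dot--ᵥ zs ys ys′) ⟩
    (z * y - z * y′) + (dot′ zs ys - dot′ zs ys′)       ≡⟨ interchange (z * y) (- (z * y′)) (dot′ zs ys) _ ⟩
    (z * y + dot′ zs ys) + (- (z * y′) + - dot′ zs ys′) ≡⟨ cong (z * y + dot′ zs ys +_) (-‿+-comm _ _) ⟩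
    (z * y + dot′ zs ys) - (z * y′ + dot′ zs ys′)       ∎
    where
    open ≡-Reasoning
    open CommutativeSemigroupProperties (CommutativeRing.+-commutativeSemigroup commutativeRing)
      using (interchange)

  -ᵥ≡0⇒≡ : ∀ {d} (y y′ : Pt 𝔽 d) → y -ᵥ y′ ≡ 0ᵥ d → y ≡ y′
  -ᵥ≡0⇒≡ []       []         _ = refl
  -ᵥ≡0⇒≡ (y ∷ ys) (y′ ∷ ys′) h = cong₂ _∷_ (x∙y⁻¹≈ε⇒x≈y y y′ (cong Vec.head h)) (-ᵥ≡0⇒≡ ys ys′ (cong Vec.tail h))

  scale-scale : ∀ {d} s t (x : Pt 𝔽 d) → scale′ s (scale′ t x) ≡ scale′ (s * t) x
  scale-scale s t []       = refl
  scale-scale s t (x ∷ xs) = cong₂ _∷_ (sym (*-assoc s t x)) (scale-scale s t xs)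

  scale-one : ∀ {d} (x : Pt 𝔽 d) → scale′ 𝟙 x ≡ x
  scale-one []       = refl
  scale-one (x ∷ xs) = cong₂ _∷_ (*-identityˡ x) (scale-one xs)

  scale≡0⇒≡0 : ∀ {d} s (x : Pt 𝔽 d) → ¬ s ≡ 𝟘 → scale′ s x ≡ 0ᵥ d → x ≡ 0ᵥ d
  scale≡0⇒≡0 s []       s≢0 h = refl
  scale≡0⇒≡0 s (x ∷ xs) s≢0 h = cong₂ _∷_ (*-zero-≢0 s x s≢0 (cong Vec.head h)) (scale≡0⇒≡0 s xs s≢0 (cong Vec.tail h))

  scale-injectiveˡ : ∀ {d} s t (x : Pt 𝔽 d) → ¬ x ≡ 0ᵥ d → scale′ s x ≡ scale′ t x → s ≡ t
  scale-injectiveˡ s t []       x≢0 h = ⊥-elim (x≢0 refl)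
  scale-injectiveˡ s t (x ∷ xs) x≢0 h with x ≟ 𝟘
  ... | no x₀≢0  = *-cancelʳ-≢0 s t x x₀≢0 (cong Vec.head h)
  ... | yes x₀≡0 = scale-injectiveˡ s t xs (λ xs≡0 → x≢0 (cong₂ _∷_ x₀≡0 xs≡0)) (cong Vec.tail h)

module PointCounting {q : ℕ} (𝔽 : FiniteField q) where
  open import Data.Nat using (ℕ; zero; suc; _*_; _^_)
  open import Data.Nat.Properties using (*-identityʳ)
  open import Data.Fin as Fin using (Fin)
  open import Data.Fin.Properties using (_≟_)
  open import Data.Vec using ([]; _∷_)
  import Data.Vec as Vec
  open import Data.Vec.Properties using (≡-dec)
  open import Data.List using (allFin)
  open import Data.List.Properties using (length-tabulate)
  open import Data.Empty using (⊥-elim)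
  open import Relation.Nullary using (¬_; yes; no)
  open import Relation.Binary.PropositionalEquality
  open import Relation.Binary.Definitions using (DecidableEquality)
  open import Function using (id)
  open FiniteSums

  open FieldAlgebra 𝔽 renaming (_+_ to _+ᶠ_; _*_ to _*ᶠ_; -_ to -ᶠ_)

  _≟ᵥ_ : ∀ {d} → DecidableEquality (Pt 𝔽 d)
  _≟ᵥ_ = ≡-dec _≟_

  ∑ᶠ : (Fin q → ℕ) → ℕ
  ∑ᶠ = ∑ (allFin q)

  ∑ᵥ : ∀ d → (Pt 𝔽 d → ℕ) → ℕ
  ∑ᵥ d = ∑ (allPts 𝔽 d)

  ∑ᵥ-suc : ∀ d (g : Pt 𝔽 (suc d) → ℕ) → ∑ᵥ (suc d) g ≡ ∑ᶠ (λ a → ∑ᵥ d (λ ys → g (a ∷ ys)))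
  ∑ᵥ-suc d g = trans (∑-concatMap _ (allFin q) g) (∑-cong (allFin q) (λ a → ∑-map (a ∷_) (allPts 𝔽 d) g))

  ∑ᶠ-const : ∀ c → ∑ᶠ (λ _ → c) ≡ q * c
  ∑ᶠ-const c = trans (∑-const (allFin q) c) (cong (_* c) (length-tabulate {n = q} id))

  ∑ᶠ-one : ∑ᶠ (λ _ → 1) ≡ q
  ∑ᶠ-one = trans (∑ᶠ-const 1) (*-identityʳ q)

  ∑ᵥ-one : ∀ d → ∑ᵥ d (λ _ → 1) ≡ q ^ d
  ∑ᵥ-one zero    = refl
  ∑ᵥ-one (suc d) = trans (∑ᵥ-suc d (λ _ → 1)) (trans (∑-cong (allFin q) (λ _ → ∑ᵥ-one d)) (∑ᶠ-const (q ^ d)))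

  allPts-enumerates : ∀ d (u : Pt 𝔽 d) → ∑ᵥ d (λ x → ⟦ x ≟ᵥ u ⟧) ≡ 1
  allPts-enumerates zero    []       = refl
  allPts-enumerates (suc d) (u ∷ us) = begin
    ∑ᵥ (suc d) (λ x → ⟦ x ≟ᵥ (u ∷ us) ⟧)                      ≡⟨ ∑ᵥ-suc d _ ⟩
    ∑ᶠ (λ a → ∑ᵥ d (λ ys → ⟦ (a ∷ ys) ≟ᵥ (u ∷ us) ⟧))          ≡⟨ ∑-cong (allFin q) (λ a → ∑-cong (allPts 𝔽 d) (⟦∷⟧ a)) ⟩
    ∑ᶠ (λ a → ∑ᵥ d (λ ys → ⟦ a ≟ u ⟧ * ⟦ ys ≟ᵥ us ⟧))          ≡⟨ ∑-cong (allFin q) (λ a → ∑-*ˡ (allPts 𝔽 d) ⟦ a ≟ u ⟧ _) ⟩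
    ∑ᶠ (λ a → ⟦ a ≟ u ⟧ * ∑ᵥ d (λ ys → ⟦ ys ≟ᵥ us ⟧))          ≡⟨ ∑-cong (allFin q) (λ a → cong (⟦ a ≟ u ⟧ *_) (allPts-enumerates d us)) ⟩
    ∑ᶠ (λ a → ⟦ a ≟ u ⟧ * 1)                                  ≡⟨ ∑-cong (allFin q) (λ a → *-identityʳ ⟦ a ≟ u ⟧) ⟩
    ∑ᶠ (λ a → ⟦ a ≟ u ⟧)                                      ≡⟨ allFin-enumerates q u ⟩
    1 ∎
    where
    open ≡-Reasoning
    ⟦∷⟧ : ∀ a ys → ⟦ (a ∷ ys) ≟ᵥ (u ∷ us) ⟧ ≡ ⟦ a ≟ u ⟧ * ⟦ ys ≟ᵥ us ⟧
    ⟦∷⟧ a ys = ⟦⟧-× ((a ∷ ys) ≟ᵥ (u ∷ us)) (a ≟ u) (ys ≟ᵥ us) (cong Vec.head) (cong Vec.tail) (cong₂ _∷_)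

  module ∑ᶠ = Enumeration _≟_ (allFin q) (allFin-enumerates q)
  module ∑ᵥ (d : ℕ) = Enumeration (_≟ᵥ_ {d}) (allPts 𝔽 d) (allPts-enumerates d)

  hyperplane-size : ∀ k (w : Pt 𝔽 (suc k)) → ¬ w ≡ 0ᵥ (suc k) → ∀ c →
                    ∑ᵥ (suc k) (λ z → ⟦ dot′ z w ≟ c ⟧) ≡ q ^ k
  hyperplane-size k (w₀ ∷ ws) w≢0 c with ws ≟ᵥ 0ᵥ k
  ... | yes refl = begin
    ∑ᵥ (suc k) (λ z → ⟦ dot′ z (w₀ ∷ 0ᵥ k) ≟ c ⟧)                ≡⟨ ∑ᵥ-suc k (λ z → ⟦ dot′ z (w₀ ∷ 0ᵥ k) ≟ c ⟧) ⟩
    ∑ᶠ (λ a → ∑ᵥ k (λ zs → ⟦ dot′ (a ∷ zs) (w₀ ∷ 0ᵥ k) ≟ c ⟧))      ≡⟨ ∑-cong (allFin q) (λ a → ∑-cong (allPts 𝔽 k) (solve a)) ⟩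
    ∑ᶠ (λ a → ∑ᵥ k (λ zs → ⟦ a ≟ a₀ ⟧ * 1))                        ≡⟨ ∑-cong (allFin q) (λ a → ∑-*ˡ (allPts 𝔽 k) ⟦ a ≟ a₀ ⟧ _) ⟩
    ∑ᶠ (λ a → ⟦ a ≟ a₀ ⟧ * ∑ᵥ k (λ _ → 1))                         ≡⟨ ∑ᶠ.∑-delta a₀ _ ⟩
    ∑ᵥ k (λ _ → 1)                                                ≡⟨ ∑ᵥ-one k ⟩
    q ^ k                                                         ∎
    where
    open ≡-Reasoning
    w₀≢0 : ¬ w₀ ≡ 𝟘
    w₀≢0 w₀≡0 = w≢0 (cong (_∷ 0ᵥ k) w₀≡0)
    a₀ = c *ᶠ inv w₀ w₀≢0
    solve : ∀ a zs → ⟦ dot′ (a ∷ zs) (w₀ ∷ 0ᵥ k) ≟ c ⟧ ≡ ⟦ a ≟ a₀ ⟧ * 1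
    solve a zs = trans (⟦⟧-cong (dot′ (a ∷ zs) (w₀ ∷ 0ᵥ k) ≟ c) (a ≟ a₀)
                         (λ e → x*w≡c⇒x≡c*w⁻¹ a w₀ c w₀≢0 (trans (sym (dot-∷-zeroʳ a w₀ zs)) e))
                         (λ e → trans (dot-∷-zeroʳ a w₀ zs) (x≡c*w⁻¹⇒x*w≡c a w₀ c w₀≢0 e)))
                       (sym (*-identityʳ _))
  hyperplane-size zero    (w₀ ∷ []) w≢0 c | no ws≢0 = ⊥-elim (ws≢0 refl)
  hyperplane-size (suc k) (w₀ ∷ ws) w≢0 c | no ws≢0 = begin
    ∑ᵥ (suc (suc k)) (λ z → ⟦ dot′ z (w₀ ∷ ws) ≟ c ⟧)                 ≡⟨ ∑ᵥ-suc (suc k) (λ z → ⟦ dot′ z (w₀ ∷ ws) ≟ c ⟧) ⟩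
    ∑ᶠ (λ a → ∑ᵥ (suc k) (λ zs → ⟦ a *ᶠ w₀ +ᶠ dot′ zs ws ≟ c ⟧))        ≡⟨ ∑-cong (allFin q) (λ a → ∑-cong (allPts 𝔽 (suc k)) (translate a)) ⟩
    ∑ᶠ (λ a → ∑ᵥ (suc k) (λ zs → ⟦ dot′ zs ws ≟ -ᶠ (a *ᶠ w₀) +ᶠ c ⟧))  ≡⟨ ∑-cong (allFin q) (λ a → hyperplane-size k ws ws≢0 (-ᶠ (a *ᶠ w₀) +ᶠ c)) ⟩
    ∑ᶠ (λ a → q ^ k)                                                  ≡⟨ ∑ᶠ-const (q ^ k) ⟩
    q ^ suc k                                                         ∎
    where
    open ≡-Reasoning
    translate : ∀ a zs → ⟦ a *ᶠ w₀ +ᶠ dot′ zs ws ≟ c ⟧ ≡ ⟦ dot′ zs ws ≟ -ᶠ (a *ᶠ w₀) +ᶠ c ⟧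
    translate a zs = ⟦⟧-cong (a *ᶠ w₀ +ᶠ dot′ zs ws ≟ c) (dot′ zs ws ≟ -ᶠ (a *ᶠ w₀) +ᶠ c)
                       (y≈x\\z (a *ᶠ w₀) (dot′ zs ws) c) (λ e → trans (cong (a *ᶠ w₀ +ᶠ_) e) (\\-leftDividesˡ (a *ᶠ w₀) c))

module Inequalities where
  open import Data.Nat
  open import Data.Nat.Properties
  open import Data.Nat.Tactic.RingSolver using (solve-∀)
  open import Data.Empty using (⊥-elim)
  open import Relation.Binary.PropositionalEquality

  private
    *-cancelˡ-≤-pos : ∀ c {a b} → 1 ≤ c → c * a ≤ c * b → a ≤ b
    *-cancelˡ-≤-pos (suc c) _ = *-cancelˡ-≤ (suc c)

  -- ∑T sums collisions over all of F_q^d, ∑T⁺ over its r = Q - 1 nonzero points, V is the excess over those.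
  excess-sum-bound : ∀ q f V ∑T ∑T⁺ r Q →
    q * ∑T + f * Q ≡ (f * f) * Q + f * (q * Q) →
    ∑T ≡ ∑T⁺ + f * f →
    q * ∑T⁺ ≡ V + r * (f * f) →
    r + 1 ≡ Q → 1 ≤ q →
    V + f * Q ≤ q * (f * Q)
  excess-sum-bound q f V ∑T ∑T⁺ r Q total split excess r+1≡Q 1≤q =
    +-cancelʳ-≤ (q * (f * f) + r * (f * f)) (V + f * Q) (q * (f * Q))
      (≤-trans (≤-reflexive balance) (+-monoʳ-≤ (q * (f * Q)) (+-monoˡ-≤ (r * (f * f)) f²≤qf²)))
    where
    open ≡-Reasoning
    f²≤qf² : f * f ≤ q * (f * f)
    f²≤qf² = subst (_≤ q * (f * f)) (*-identityˡ (f * f)) (*-monoˡ-≤ (f * f) 1≤q)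
    balance : (V + f * Q) + (q * (f * f) + r * (f * f)) ≡ q * (f * Q) + (f * f + r * (f * f))
    balance = begin
      (V + f * Q) + (q * (f * f) + r * (f * f))  ≡⟨ regroup₁ V f Q q r ⟩
      (V + r * (f * f)) + q * (f * f) + f * Q    ≡⟨ cong (λ w → w + q * (f * f) + f * Q) (sym excess) ⟩
      q * ∑T⁺ + q * (f * f) + f * Q              ≡⟨ regroup₂ q ∑T⁺ f Q ⟩
      q * (∑T⁺ + f * f) + f * Q                  ≡⟨ cong (λ w → q * w + f * Q) (sym split) ⟩
      q * ∑T + f * Q                             ≡⟨ total ⟩
      (f * f) * Q + f * (q * Q)                  ≡⟨ cong (λ w → (f * f) * w + f * (q * Q)) (sym r+1≡Q) ⟩
      (f * f) * (r + 1) + f * (q * Q)            ≡⟨ regroup₃ f r q Q ⟩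
      q * (f * Q) + (f * f + r * (f * f))        ∎
      where
      regroup₁ : ∀ V f Q q r → (V + f * Q) + (q * (f * f) + r * (f * f)) ≡ (V + r * (f * f)) + q * (f * f) + f * Q
      regroup₁ = solve-∀
      regroup₂ : ∀ q S f Q → q * S + q * (f * f) + f * Q ≡ q * (S + f * f) + f * Q
      regroup₂ = solve-∀
      regroup₃ : ∀ f r q Q → (f * f) * (r + 1) + f * (q * Q) ≡ q * (f * Q) + (f * f + r * (f * f))
      regroup₃ = solve-∀

  excess-bound : ∀ q r Q N V A f →
    r + 1 ≡ q → 1 ≤ r → 1 ≤ Q →
    4 * (Q * (r * A)) ≤ N * V →
    V + f * Q ≤ q * (f * Q) →
    4 * A ≤ N * f
  excess-bound q r Q N V A f r+1≡q 1≤r 1≤Q lines total = *-cancelˡ-≤-pos (r * Q) (*-mono-≤ 1≤r 1≤Q) (begin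
    r * Q * (4 * A)       ≡⟨ regroup₁ r Q A ⟩
    4 * (Q * (r * A))     ≤⟨ lines ⟩
    N * V                 ≤⟨ *-monoʳ-≤ N V≤rfQ ⟩
    N * (r * (f * Q))     ≡⟨ regroup₂ N r f Q ⟩
    r * Q * (N * f)       ∎)
    where
    open ≤-Reasoning
    regroup₁ : ∀ r Q A → r * Q * (4 * A) ≡ 4 * (Q * (r * A))
    regroup₁ = solve-∀
    regroup₂ : ∀ N r f Q → N * (r * (f * Q)) ≡ r * Q * (N * f)
    regroup₂ = solve-∀
    V≤rfQ : V ≤ r * (f * Q)
    V≤rfQ = +-cancelʳ-≤ (f * Q) V (r * (f * Q)) (≤-trans total (≤-reflexive (trans (cong (_* (f * Q)) (sym r+1≡q)) (expand r (f * Q)))))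
      where
      expand : ∀ r x → (r + 1) * x ≡ r * x + x
      expand = solve-∀

  size-bound : ∀ N e m f Q → N ≡ e * f → e ≤ m + 1 → 4 * Q ≤ N → f ≤ Q → 3 * N ≤ 4 * (m * f)
  size-bound N e m f Q N≡ef e≤m+1 4Q≤N f≤Q = +-cancelʳ-≤ N (3 * N) (4 * (m * f)) (begin
    3 * N + N                 ≡⟨ +-comm (3 * N) N ⟩
    4 * N                     ≡⟨ cong (4 *_) N≡ef ⟩
    4 * (e * f)               ≤⟨ *-monoʳ-≤ 4 (*-monoˡ-≤ f e≤m+1) ⟩
    4 * ((m + 1) * f)         ≡⟨ expand m f ⟩
    4 * (m * f) + 4 * f       ≤⟨ +-monoʳ-≤ (4 * (m * f)) (≤-trans (*-monoʳ-≤ 4 f≤Q) 4Q≤N) ⟩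
    4 * (m * f) + N           ∎)
    where
    open ≤-Reasoning
    expand : ∀ m f → 4 * ((m + 1) * f) ≡ 4 * (m * f) + 4 * f
    expand = solve-∀

  -- With P = m f: 4qP² ≤ Π(4P² + 4mA) ≤ Π P (4P + N) ≤ (16/3) Π P², so 3q ≤ 4Π.
  product-set-bound : ∀ q m f A N S ∑T Π →
    (m * f) * (m * f) ≤ Π * S →
    S ≤ m * ∑T →
    q * ∑T ≡ m * (f * f) + A →
    4 * A ≤ N * f →
    3 * N ≤ 4 * (m * f) →
    1 ≤ N →
    q ≤ 2 * Π
  product-set-bound q m f A N S ∑T Π P²≤ΠS S≤m∑T q∑T 4A≤Nf 3N≤4P 1≤N = *-cancelˡ-≤-pos 3 (s≤s z≤n) (begin
    3 * q        ≤⟨ 3q≤4Π ⟩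
    4 * Π        ≤⟨ *-monoˡ-≤ Π (m≤m+n 4 2) ⟩
    6 * Π        ≡⟨ *-assoc 3 2 Π ⟩
    3 * (2 * Π)  ∎)
    where
    open ≤-Reasoning
    P = m * f
    1≤P : 1 ≤ P
    1≤P with P
    ... | zero  = ⊥-elim (<⇒≱ (s≤s z≤n) (≤-trans (*-monoʳ-≤ 3 1≤N) 3N≤4P))
    ... | suc _ = s≤s z≤n
    4qP≤Π[4P+N] : (4 * q) * P ≤ Π * (4 * P + N)
    4qP≤Π[4P+N] = *-cancelˡ-≤-pos P 1≤P (begin
      P * ((4 * q) * P)              ≡⟨ regroup₁ P q ⟩
      q * (4 * (P * P))              ≤⟨ *-monoʳ-≤ q (*-monoʳ-≤ 4 P²≤ΠS) ⟩
      q * (4 * (Π * S))              ≡⟨ regroup₂ q Π S ⟩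
      Π * (4 * (q * S))              ≤⟨ *-monoʳ-≤ Π (*-monoʳ-≤ 4 (*-monoʳ-≤ q S≤m∑T)) ⟩
      Π * (4 * (q * (m * ∑T)))       ≡⟨ cong (λ w → Π * (4 * w)) (trans (regroup₃ q m ∑T) (cong (m *_) q∑T)) ⟩
      Π * (4 * (m * (m * (f * f) + A))) ≡⟨ cong (Π *_) (regroup₄ m f A) ⟩
      Π * (4 * (P * P) + m * (4 * A)) ≤⟨ *-monoʳ-≤ Π (+-monoʳ-≤ (4 * (P * P)) (*-monoʳ-≤ m 4A≤Nf)) ⟩
      Π * (4 * (P * P) + m * (N * f)) ≡⟨ regroup₅ Π m f N ⟩
      P * (Π * (4 * P + N))          ∎)
      where
      regroup₁ : ∀ P q → P * ((4 * q) * P) ≡ q * (4 * (P * P))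
      regroup₁ = solve-∀
      regroup₂ : ∀ q Π S → q * (4 * (Π * S)) ≡ Π * (4 * (q * S))
      regroup₂ = solve-∀
      regroup₃ : ∀ q m S → q * (m * S) ≡ m * (q * S)
      regroup₃ = solve-∀
      regroup₄ : ∀ m f A → 4 * (m * (m * (f * f) + A)) ≡ 4 * ((m * f) * (m * f)) + m * (4 * A)
      regroup₄ = solve-∀
      regroup₅ : ∀ Π m f N → Π * (4 * ((m * f) * (m * f)) + m * (N * f)) ≡ (m * f) * (Π * (4 * (m * f) + N))
      regroup₅ = solve-∀
    3q≤4Π : 3 * q ≤ 4 * Π
    3q≤4Π = *-cancelˡ-≤-pos (4 * P) (≤-trans 1≤P (m≤n*m P 4)) (begin
      4 * P * (3 * q)          ≡⟨ regroup₁ P q ⟩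
      3 * ((4 * q) * P)        ≤⟨ *-monoʳ-≤ 3 4qP≤Π[4P+N] ⟩
      3 * (Π * (4 * P + N))    ≡⟨ regroup₂ Π P N ⟩
      Π * (12 * P + 3 * N)     ≤⟨ *-monoʳ-≤ Π (+-monoʳ-≤ (12 * P) 3N≤4P) ⟩
      Π * (12 * P + 4 * P)     ≡⟨ regroup₃ Π P ⟩
      4 * P * (4 * Π)          ∎)
      where
      regroup₁ : ∀ P q → 4 * P * (3 * q) ≡ 3 * ((4 * q) * P)
      regroup₁ = solve-∀
      regroup₂ : ∀ Π P N → 3 * (Π * (4 * P + N)) ≡ Π * (12 * P + 3 * N)
      regroup₂ = solve-∀
      regroup₃ : ∀ Π P → Π * (12 * P + 4 * P) ≡ 4 * P * (4 * Π)
      regroup₃ = solve-∀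

module ProductSetBound {q : ℕ} (𝔽 : FiniteField q) (k : ℕ) (E F : Pt 𝔽 (suc k) → Bool) where
  open import Data.Nat using (ℕ; suc; _+_; _*_; _^_; _∸_; _≤_; z≤n; s≤s)
  open import Data.Nat.Properties renaming (_≟_ to _≟ℕ_)
  open import Algebra.Properties.CommutativeSemigroup *-commutativeSemigroup
    using () renaming (interchange to *-interchange)
  open import Data.Nat.Tactic.RingSolver using (solve-∀)
  open import Data.Bool using (Bool; true; false; T; _∧_; not)
  open import Data.Bool.Properties using (T-≡)
  open import Data.Bool.ListAction using (any)
  open import Data.Fin using (Fin)
  open import Data.Fin.Properties using (_≟_)
  open import Data.List using (allFin)
  open import Data.List.Membership.Propositional using (lose)
  open import Data.List.Membership.Propositional.Properties using (∈-allFin)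
  open import Data.List.Relation.Unary.Any.Properties using (any⁺)
  open import Data.Product using (_,_; _×_; proj₁; proj₂)
  open import Data.Empty using (⊥-elim)
  open import Data.Unit using (tt)
  open import Function using (_∘_)
  open import Function.Bundles using (Equivalence)
  open import Relation.Nullary using (¬_; Dec; yes; no; does; ¬?)
  open import Relation.Nullary.Decidable using (dec-true; dec-false)
  open import Relation.Binary.PropositionalEquality
  open FiniteSums
  open Inequalities

  open FieldAlgebra 𝔽 hiding (_+_; -_; _-_) renaming (_*_ to _*ᶠ_)
  open PointCounting 𝔽

  D Q : ℕ
  D = suc k
  Q = q ^ D

  Point : Set
  Point = Pt 𝔽 D

  ∑ₚ : (Point → ℕ) → ℕ
  ∑ₚ = ∑ᵥ D

  ∑∑ : (Point → Point → ℕ) → ℕ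
  ∑∑ g = ∑ₚ (λ y → ∑ₚ (g y))

  nonzeroᶠ : Fin q → ℕ
  nonzeroᶠ s = ⟦ ¬? (s ≟ 𝟘) ⟧

  nonzero : Point → ℕ
  nonzero x = ⟦ ¬? (x ≟ᵥ 0ᵥ D) ⟧

  𝟏F 𝟏E 𝟏E⁺ : Point → ℕ
  𝟏F y  = χ (F y)
  𝟏E x  = χ (E x)
  𝟏E⁺ x = 𝟏E x * nonzero x

  #F #E #E⁺ : ℕ
  #F  = ∑ₚ 𝟏F
  #E  = ∑ₚ 𝟏E
  #E⁺ = ∑ₚ 𝟏E⁺

  fibre : Point → Fin q → ℕ
  fibre x t = ∑ₚ (λ y → 𝟏F y * ⟦ dot′ x y ≟ t ⟧)

  collisions : Point → ℕ
  collisions x = ∑∑ (λ y y′ → (𝟏F y * 𝟏F y′) * ⟦ dot′ x y ≟ dot′ x y′ ⟧)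

  representations : Fin q → ℕ
  representations t = ∑ₚ (λ x → 𝟏E⁺ x * fibre x t)

  excess : Point → ℕ
  excess x = q * collisions x ∸ #F * #F

  ∑-fibre : ∀ x → ∑ᶠ (fibre x) ≡ #F
  ∑-fibre x = begin
    ∑ᶠ (λ t → ∑ₚ (λ y → 𝟏F y * ⟦ dot′ x y ≟ t ⟧))  ≡⟨ ∑-swap (allFin q) (allPts 𝔽 D) (λ t y → 𝟏F y * ⟦ dot′ x y ≟ t ⟧) ⟩
    ∑ₚ (λ y → ∑ᶠ (λ t → 𝟏F y * ⟦ dot′ x y ≟ t ⟧))  ≡⟨ ∑-cong (allPts 𝔽 D) (λ y → ∑-*ˡ (allFin q) (𝟏F y) (λ t → ⟦ dot′ x y ≟ t ⟧)) ⟩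
    ∑ₚ (λ y → 𝟏F y * ∑ᶠ (λ t → ⟦ dot′ x y ≟ t ⟧))  ≡⟨ ∑-cong (allPts 𝔽 D) (λ y → cong (𝟏F y *_) (∑ᶠ.enumerates′ (dot′ x y))) ⟩
    ∑ₚ (λ y → 𝟏F y * 1)                          ≡⟨ ∑-cong (allPts 𝔽 D) (λ y → *-identityʳ (𝟏F y)) ⟩
    #F ∎
    where open ≡-Reasoning

  ∑-fibre² : ∀ x → ∑ᶠ (λ t → fibre x t * fibre x t) ≡ collisions x
  ∑-fibre² x = begin
    ∑ᶠ (λ t → fibre x t * fibre x t)               ≡⟨ ∑-cong (allFin q) expand ⟩
    ∑ᶠ (λ t → ∑∑ (λ y y′ → g t y y′))              ≡⟨ ∑-swap (allFin q) (allPts 𝔽 D) (λ t y → ∑ₚ (g t y)) ⟩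
    ∑ₚ (λ y → ∑ᶠ (λ t → ∑ₚ (g t y)))               ≡⟨ ∑-cong (allPts 𝔽 D) (λ y → ∑-swap (allFin q) (allPts 𝔽 D) (λ t → g t y)) ⟩
    ∑∑ (λ y y′ → ∑ᶠ (λ t → g t y y′))              ≡⟨ ∑-cong (allPts 𝔽 D) (λ y → ∑-cong (allPts 𝔽 D) (sum-over-t y)) ⟩
    collisions x                                   ∎
    where
    open ≡-Reasoning
    g : Fin q → Point → Point → ℕ
    g t y y′ = (𝟏F y * ⟦ dot′ x y ≟ t ⟧) * (𝟏F y′ * ⟦ dot′ x y′ ≟ t ⟧)
    expand : ∀ t → fibre x t * fibre x t ≡ ∑∑ (g t)
    expand t = trans (sym (∑-*ʳ (allPts 𝔽 D) (fibre x t) (λ y → 𝟏F y * ⟦ dot′ x y ≟ t ⟧)))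
                     (∑-cong (allPts 𝔽 D) (λ y → sym (∑-*ˡ (allPts 𝔽 D) (𝟏F y * ⟦ dot′ x y ≟ t ⟧) (λ y′ → 𝟏F y′ * ⟦ dot′ x y′ ≟ t ⟧))))
    sum-over-t : ∀ y y′ → ∑ᶠ (λ t → g t y y′) ≡ (𝟏F y * 𝟏F y′) * ⟦ dot′ x y ≟ dot′ x y′ ⟧
    sum-over-t y y′ = begin
      ∑ᶠ (λ t → g t y y′)
        ≡⟨ ∑-cong (allFin q) (λ t → *-interchange (𝟏F y) _ (𝟏F y′) _) ⟩
      ∑ᶠ (λ t → (𝟏F y * 𝟏F y′) * (⟦ dot′ x y ≟ t ⟧ * ⟦ dot′ x y′ ≟ t ⟧))
        ≡⟨ ∑-*ˡ (allFin q) (𝟏F y * 𝟏F y′) _ ⟩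
      (𝟏F y * 𝟏F y′) * ∑ᶠ (λ t → ⟦ dot′ x y ≟ t ⟧ * ⟦ dot′ x y′ ≟ t ⟧)
        ≡⟨ cong ((𝟏F y * 𝟏F y′) *_) (trans (∑ᶠ.∑-delta′ (dot′ x y) _) (∑ᶠ.⟦≟⟧-sym (dot′ x y) (dot′ x y′))) ⟩
      (𝟏F y * 𝟏F y′) * ⟦ dot′ x y ≟ dot′ x y′ ⟧ ∎

  #F²≤q*collisions : ∀ x → #F * #F ≤ q * collisions x
  #F²≤q*collisions x =
    subst₂ _≤_ (cong₂ _*_ ∑1*fibre ∑1*fibre) (cong₂ _*_ ∑ᶠ-one (∑-fibre² x))
      (cauchy-schwarz (allFin q) (λ _ → 1) (fibre x))
    where
    ∑1*fibre : ∑ᶠ (λ t → 1 * fibre x t) ≡ #F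
    ∑1*fibre = trans (∑-cong (allFin q) (λ t → *-identityˡ (fibre x t))) (∑-fibre x)

  -- The truncated subtraction in excess is exact, by #F²≤q*collisions.
  q*collisions≡ : ∀ x → q * collisions x ≡ #F * #F + excess x
  q*collisions≡ x = sym (m+[n∸m]≡n (#F²≤q*collisions x))

  𝟏E⁺-idem : ∀ x → 𝟏E⁺ x * 𝟏E⁺ x ≡ 𝟏E⁺ x
  𝟏E⁺-idem x = trans (*-interchange (𝟏E x) (nonzero x) (𝟏E x) (nonzero x))
                     (cong₂ _*_ (χ-idem (E x)) (⟦⟧-idem (¬? (x ≟ᵥ 0ᵥ D))))

  ∑-representations : ∑ᶠ representations ≡ #E⁺ * #F
  ∑-representations = begin
    ∑ᶠ (λ t → ∑ₚ (λ x → 𝟏E⁺ x * fibre x t))  ≡⟨ ∑-swap (allFin q) (allPts 𝔽 D) (λ t x → 𝟏E⁺ x * fibre x t) ⟩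
    ∑ₚ (λ x → ∑ᶠ (λ t → 𝟏E⁺ x * fibre x t))  ≡⟨ ∑-cong (allPts 𝔽 D) (λ x → ∑-*ˡ (allFin q) (𝟏E⁺ x) (fibre x)) ⟩
    ∑ₚ (λ x → 𝟏E⁺ x * ∑ᶠ (fibre x))          ≡⟨ ∑-cong (allPts 𝔽 D) (λ x → cong (𝟏E⁺ x *_) (∑-fibre x)) ⟩
    ∑ₚ (λ x → 𝟏E⁺ x * #F)                    ≡⟨ ∑-*ʳ (allPts 𝔽 D) #F 𝟏E⁺ ⟩
    #E⁺ * #F                                 ∎
    where open ≡-Reasoning

  representations² : ∀ t → representations t * representations t ≤ #E⁺ * ∑ₚ (λ x → 𝟏E⁺ x * (fibre x t * fibre x t))
  representations² t =
    subst₂ _≤_ (cong₂ _*_ weighted weighted) (cong₂ _*_ (∑-cong (allPts 𝔽 D) 𝟏E⁺-idem) squared)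
      (cauchy-schwarz (allPts 𝔽 D) 𝟏E⁺ (λ x → 𝟏E⁺ x * fibre x t))
    where
    weighted : ∑ₚ (λ x → 𝟏E⁺ x * (𝟏E⁺ x * fibre x t)) ≡ representations t
    weighted = ∑-cong (allPts 𝔽 D) (λ x → trans (sym (*-assoc (𝟏E⁺ x) (𝟏E⁺ x) (fibre x t))) (cong (_* fibre x t) (𝟏E⁺-idem x)))
    squared : ∑ₚ (λ x → (𝟏E⁺ x * fibre x t) * (𝟏E⁺ x * fibre x t)) ≡ ∑ₚ (λ x → 𝟏E⁺ x * (fibre x t * fibre x t))
    squared = ∑-cong (allPts 𝔽 D) (λ x → trans (*-interchange (𝟏E⁺ x) (fibre x t) (𝟏E⁺ x) (fibre x t))
                                                (cong (_* (fibre x t * fibre x t)) (𝟏E⁺-idem x)))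

  ∑-representations² : ∑ᶠ (λ t → representations t * representations t) ≤ #E⁺ * ∑ₚ (λ x → 𝟏E⁺ x * collisions x)
  ∑-representations² = begin
    ∑ᶠ (λ t → representations t * representations t)             ≤⟨ ∑-mono (allFin q) representations² ⟩
    ∑ᶠ (λ t → #E⁺ * ∑ₚ (λ x → 𝟏E⁺ x * (fibre x t * fibre x t)))  ≡⟨ ∑-*ˡ (allFin q) #E⁺ _ ⟩
    #E⁺ * ∑ᶠ (λ t → ∑ₚ (λ x → 𝟏E⁺ x * (fibre x t * fibre x t)))
      ≡⟨ cong (#E⁺ *_) (∑-swap (allFin q) (allPts 𝔽 D) (λ t x → 𝟏E⁺ x * (fibre x t * fibre x t))) ⟩
    #E⁺ * ∑ₚ (λ x → ∑ᶠ (λ t → 𝟏E⁺ x * (fibre x t * fibre x t)))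
      ≡⟨ cong (#E⁺ *_) (∑-cong (allPts 𝔽 D) (λ x → trans (∑-*ˡ (allFin q) (𝟏E⁺ x) _) (cong (𝟏E⁺ x *_) (∑-fibre² x)))) ⟩
    #E⁺ * ∑ₚ (λ x → 𝟏E⁺ x * collisions x)                         ∎
    where open ≤-Reasoning

  ∑E⁺-excess : ℕ
  ∑E⁺-excess = ∑ₚ (λ x → 𝟏E⁺ x * excess x)

  q*∑E⁺-collisions : q * ∑ₚ (λ x → 𝟏E⁺ x * collisions x) ≡ #E⁺ * (#F * #F) + ∑E⁺-excess
  q*∑E⁺-collisions = begin
    q * ∑ₚ (λ x → 𝟏E⁺ x * collisions x)                ≡⟨ sym (∑-*ˡ (allPts 𝔽 D) q _) ⟩
    ∑ₚ (λ x → q * (𝟏E⁺ x * collisions x))              ≡⟨ ∑-cong (allPts 𝔽 D) split ⟩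
    ∑ₚ (λ x → 𝟏E⁺ x * (#F * #F) + 𝟏E⁺ x * excess x)    ≡⟨ ∑-distrib-+ (allPts 𝔽 D) _ _ ⟩
    ∑ₚ (λ x → 𝟏E⁺ x * (#F * #F)) + ∑E⁺-excess          ≡⟨ cong (_+ ∑E⁺-excess) (∑-*ʳ (allPts 𝔽 D) (#F * #F) 𝟏E⁺) ⟩
    #E⁺ * (#F * #F) + ∑E⁺-excess                       ∎
    where
    open ≡-Reasoning
    split : ∀ x → q * (𝟏E⁺ x * collisions x) ≡ 𝟏E⁺ x * (#F * #F) + 𝟏E⁺ x * excess x
    split x = begin
      q * (𝟏E⁺ x * collisions x)  ≡⟨ *-comm q _ ⟩
      𝟏E⁺ x * collisions x * q    ≡⟨ *-assoc (𝟏E⁺ x) _ q ⟩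
      𝟏E⁺ x * (collisions x * q)  ≡⟨ cong (𝟏E⁺ x *_) (trans (*-comm (collisions x) q) (q*collisions≡ x)) ⟩
      𝟏E⁺ x * (#F * #F + excess x) ≡⟨ *-distribˡ-+ (𝟏E⁺ x) (#F * #F) (excess x) ⟩
      𝟏E⁺ x * (#F * #F) + 𝟏E⁺ x * excess x ∎

  inΠ : Fin q → Bool
  inΠ t = any (λ x → any (λ y → E x ∧ F y ∧ does (dot′ x y ≟ t)) (allPts 𝔽 D)) (allPts 𝔽 D)

  representations-outside-Π : ∀ t → inΠ t ≡ false → representations t ≡ 0
  representations-outside-Π t t∉Π = n≤0⇒n≡0 (begin
    ∑ₚ (λ x → 𝟏E⁺ x * fibre x t)                             ≤⟨ ∑-mono (allPts 𝔽 D) (λ x → *-monoˡ-≤ (fibre x t) (𝟏E⁺≤𝟏E x)) ⟩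
    ∑ₚ (λ x → 𝟏E x * fibre x t)                              ≡⟨ ∑-cong (allPts 𝔽 D) (λ x → sym (∑-*ˡ (allPts 𝔽 D) (𝟏E x) _)) ⟩
    ∑ₚ (λ x → ∑ₚ (λ y → 𝟏E x * (𝟏F y * ⟦ dot′ x y ≟ t ⟧)))  ≡⟨ ∑-any-false (allPts 𝔽 D) _ _ no-pair-for t∉Π ⟩
    0                                                        ∎)
    where
    open ≤-Reasoning
    𝟏E⁺≤𝟏E : ∀ x → 𝟏E⁺ x ≤ 𝟏E x
    𝟏E⁺≤𝟏E x = subst (𝟏E⁺ x ≤_) (*-identityʳ (𝟏E x)) (*-monoʳ-≤ (𝟏E x) (⟦⟧-≤1 (¬? (x ≟ᵥ 0ᵥ D))))
    pair : ∀ x y → 𝟏E x * (𝟏F y * ⟦ dot′ x y ≟ t ⟧) ≡ χ (E x ∧ F y ∧ does (dot′ x y ≟ t))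
    pair x y = sym (trans (χ-∧ (E x) _) (cong (𝟏E x *_) (χ-∧ (F y) _)))
    no-pair-for : ∀ x → any (λ y → E x ∧ F y ∧ does (dot′ x y ≟ t)) (allPts 𝔽 D) ≡ false →
                  ∑ₚ (λ y → 𝟏E x * (𝟏F y * ⟦ dot′ x y ≟ t ⟧)) ≡ 0
    no-pair-for x = ∑-any-false (allPts 𝔽 D) _ _ (λ y e → trans (pair x y) (cong χ e))

  -- Cauchy–Schwarz over the support of the representation function, which lies in Π(E, F).
  #E⁺#F²≤|Π|*∑representations² : (#E⁺ * #F) * (#E⁺ * #F) ≤ cardΠ 𝔽 E F * ∑ᶠ (λ t → representations t * representations t)
  #E⁺#F²≤|Π|*∑representations² =
    subst₂ _≤_ (cong₂ _*_ supported supported)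
               (cong (_* ∑ᶠ (λ t → representations t * representations t)) (trans (∑-cong (allFin q) (χ-idem ∘ inΠ)) (sym |Π|≡)))
      (cauchy-schwarz (allFin q) (χ ∘ inΠ) representations)
    where
    |Π|≡ : cardΠ 𝔽 E F ≡ ∑ᶠ (χ ∘ inΠ)
    |Π|≡ = length-filter (allFin q) inΠ
    restrict : ∀ t → χ (inΠ t) * representations t ≡ representations t
    restrict t with inΠ t in t∈?Π
    ... | true  = +-identityʳ (representations t)
    ... | false = sym (representations-outside-Π t t∈?Π)
    supported : ∑ᶠ (λ t → χ (inΠ t) * representations t) ≡ #E⁺ * #F
    supported = trans (∑-cong (allFin q) restrict) ∑-representations

  collisions-scale : ∀ s x → ¬ s ≡ 𝟘 → collisions (scale′ s x) ≡ collisions x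
  collisions-scale s x s≢0 = ∑-cong (allPts 𝔽 D) (λ y → ∑-cong (allPts 𝔽 D) (λ y′ → cong (𝟏F y * 𝟏F y′ *_)
    (⟦⟧-cong (dot′ (scale′ s x) y ≟ dot′ (scale′ s x) y′) (dot′ x y ≟ dot′ x y′)
      (λ e → *-cancelˡ-≢0 s _ _ s≢0 (trans (sym (dot-scaleˡ s x y)) (trans e (dot-scaleˡ s x y′))))
      (λ e → trans (dot-scaleˡ s x y) (trans (cong (s *ᶠ_) e) (sym (dot-scaleˡ s x y′)))))))

  excess-scale : ∀ s x → ¬ s ≡ 𝟘 → excess (scale′ s x) ≡ excess x
  excess-scale s x s≢0 = cong (λ c → q * c ∸ #F * #F) (collisions-scale s x s≢0)

  scalings : Point → Point → ℕ
  scalings x z = ∑ᶠ (λ s → nonzeroᶠ s * ⟦ scale′ s x ≟ᵥ z ⟧)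

  lineWeight : Point → ℕ
  lineWeight z = ∑ₚ (λ x → 𝟏E⁺ x * scalings x z)

  excess-at-multiple : ∀ x s → 𝟏E⁺ x * excess x * nonzeroᶠ s ≡ 𝟏E⁺ x * nonzeroᶠ s * excess (scale′ s x)
  excess-at-multiple x s = by-cases (s ≟ 𝟘)
    where
    open ≡-Reasoning
    by-cases : Dec (s ≡ 𝟘) → 𝟏E⁺ x * excess x * nonzeroᶠ s ≡ 𝟏E⁺ x * nonzeroᶠ s * excess (scale′ s x)
    by-cases (yes s≡0) = begin
      𝟏E⁺ x * excess x * nonzeroᶠ s             ≡⟨ cong (𝟏E⁺ x * excess x *_) s-zero ⟩
      𝟏E⁺ x * excess x * 0                      ≡⟨ *-zeroʳ (𝟏E⁺ x * excess x) ⟩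
      0                                         ≡⟨ cong (_* excess (scale′ s x)) (sym (*-zeroʳ (𝟏E⁺ x))) ⟩
      𝟏E⁺ x * 0 * excess (scale′ s x)           ≡⟨ cong (λ n → 𝟏E⁺ x * n * excess (scale′ s x)) (sym s-zero) ⟩
      𝟏E⁺ x * nonzeroᶠ s * excess (scale′ s x)  ∎
      where
      s-zero : nonzeroᶠ s ≡ 0
      s-zero = ⟦⟧-no (¬? (s ≟ 𝟘)) (λ s≢0 → s≢0 s≡0)
    by-cases (no s≢0) = begin
      𝟏E⁺ x * excess x * nonzeroᶠ s             ≡⟨ cong (𝟏E⁺ x * excess x *_) s-one ⟩
      𝟏E⁺ x * excess x * 1                      ≡⟨ *-identityʳ (𝟏E⁺ x * excess x) ⟩
      𝟏E⁺ x * excess x                          ≡⟨ cong₂ _*_ (sym (*-identityʳ (𝟏E⁺ x))) (sym (excess-scale s x s≢0)) ⟩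
      𝟏E⁺ x * 1 * excess (scale′ s x)           ≡⟨ cong (λ n → 𝟏E⁺ x * n * excess (scale′ s x)) (sym s-one) ⟩
      𝟏E⁺ x * nonzeroᶠ s * excess (scale′ s x)  ∎
      where
      s-one : nonzeroᶠ s ≡ 1
      s-one = ⟦⟧-yes (¬? (s ≟ 𝟘)) s≢0

  -- excess is constant on punctured lines, so the q - 1 nonzero multiples s x of each x carry the same weight.
  ∑E⁺-excess-by-lines : ∑ᶠ nonzeroᶠ * ∑E⁺-excess ≡ ∑ₚ (λ z → excess z * lineWeight z)
  ∑E⁺-excess-by-lines = begin
    ∑ᶠ nonzeroᶠ * ∑E⁺-excess                                   ≡⟨ *-comm (∑ᶠ nonzeroᶠ) ∑E⁺-excess ⟩
    ∑E⁺-excess * ∑ᶠ nonzeroᶠ                                   ≡⟨ sym (∑-*ʳ (allPts 𝔽 D) (∑ᶠ nonzeroᶠ) _) ⟩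
    ∑ₚ (λ x → 𝟏E⁺ x * excess x * ∑ᶠ nonzeroᶠ)                  ≡⟨ ∑-cong (allPts 𝔽 D) (λ x → sym (∑-*ˡ (allFin q) (𝟏E⁺ x * excess x) nonzeroᶠ)) ⟩
    ∑ₚ (λ x → ∑ᶠ (λ s → 𝟏E⁺ x * excess x * nonzeroᶠ s))        ≡⟨ ∑-cong (allPts 𝔽 D) (λ x → ∑-cong (allFin q) (excess-at-multiple x)) ⟩
    ∑ₚ (λ x → ∑ᶠ (λ s → 𝟏E⁺ x * nonzeroᶠ s * excess (scale′ s x)))
      ≡⟨ ∑-cong (allPts 𝔽 D) (λ x → ∑-cong (allFin q) (spread x)) ⟩
    ∑ₚ (λ x → ∑ᶠ (λ s → ∑ₚ (λ z → excess z * w x s z)))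
      ≡⟨ ∑-cong (allPts 𝔽 D) (λ x → ∑-swap (allFin q) (allPts 𝔽 D) (λ s z → excess z * w x s z)) ⟩
    ∑ₚ (λ x → ∑ₚ (λ z → ∑ᶠ (λ s → excess z * w x s z)))
      ≡⟨ ∑-swap (allPts 𝔽 D) (allPts 𝔽 D) (λ x z → ∑ᶠ (λ s → excess z * w x s z)) ⟩
    ∑ₚ (λ z → ∑ₚ (λ x → ∑ᶠ (λ s → excess z * w x s z)))        ≡⟨ ∑-cong (allPts 𝔽 D) factor ⟩
    ∑ₚ (λ z → excess z * lineWeight z)                         ∎
    where
    open ≡-Reasoning
    w : Point → Fin q → Point → ℕ
    w x s z = 𝟏E⁺ x * nonzeroᶠ s * ⟦ scale′ s x ≟ᵥ z ⟧
    spread : ∀ x s → 𝟏E⁺ x * nonzeroᶠ s * excess (scale′ s x) ≡ ∑ₚ (λ z → excess z * w x s z)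
    spread x s = begin
      𝟏E⁺ x * nonzeroᶠ s * excess (scale′ s x)
        ≡⟨ cong (𝟏E⁺ x * nonzeroᶠ s *_) (sym (∑ᵥ.∑-delta′ D (scale′ s x) excess)) ⟩
      𝟏E⁺ x * nonzeroᶠ s * ∑ₚ (λ z → ⟦ scale′ s x ≟ᵥ z ⟧ * excess z)
        ≡⟨ sym (∑-*ˡ (allPts 𝔽 D) (𝟏E⁺ x * nonzeroᶠ s) (λ z → ⟦ scale′ s x ≟ᵥ z ⟧ * excess z)) ⟩
      ∑ₚ (λ z → 𝟏E⁺ x * nonzeroᶠ s * (⟦ scale′ s x ≟ᵥ z ⟧ * excess z))
        ≡⟨ ∑-cong (allPts 𝔽 D) (λ z → regroup (𝟏E⁺ x * nonzeroᶠ s) ⟦ scale′ s x ≟ᵥ z ⟧ (excess z)) ⟩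
      ∑ₚ (λ z → excess z * w x s z) ∎
      where
      regroup : ∀ a b c → a * (b * c) ≡ c * (a * b)
      regroup = solve-∀
    factor : ∀ z → ∑ₚ (λ x → ∑ᶠ (λ s → excess z * w x s z)) ≡ excess z * lineWeight z
    factor z = begin
      ∑ₚ (λ x → ∑ᶠ (λ s → excess z * w x s z))            ≡⟨ ∑-cong (allPts 𝔽 D) (λ x → ∑-*ˡ (allFin q) (excess z) (λ s → w x s z)) ⟩
      ∑ₚ (λ x → excess z * ∑ᶠ (λ s → w x s z))            ≡⟨ ∑-*ˡ (allPts 𝔽 D) (excess z) _ ⟩
      excess z * ∑ₚ (λ x → ∑ᶠ (λ s → w x s z))            ≡⟨ cong (excess z *_) (∑-cong (allPts 𝔽 D) pull) ⟩
      excess z * lineWeight z                            ∎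
      where
      pull : ∀ x → ∑ᶠ (λ s → w x s z) ≡ 𝟏E⁺ x * scalings x z
      pull x = trans (∑-cong (allFin q) (λ s → *-assoc (𝟏E⁺ x) (nonzeroᶠ s) _)) (∑-*ˡ (allFin q) (𝟏E⁺ x) _)

  inLine-scaled : ∀ (x z : Point) s → ¬ s ≡ 𝟘 → scale′ s x ≡ z → inLine 𝔽 z x ≡ true
  inLine-scaled x z s s≢0 sx≡z = Equivalence.to T-≡ (any⁺ _ (lose (∈-allFin s⁻¹) s⁻¹-witnesses))
    where
    s⁻¹ = inv s s≢0
    s⁻¹z≡x : scale′ s⁻¹ z ≡ x
    s⁻¹z≡x = begin
      scale′ s⁻¹ z               ≡⟨ cong (scale′ s⁻¹) (sym sx≡z) ⟩
      scale′ s⁻¹ (scale′ s x)    ≡⟨ scale-scale s⁻¹ s x ⟩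
      scale′ (s⁻¹ *ᶠ s) x        ≡⟨ cong (λ c → scale′ c x) (*-inverseˡ s s≢0) ⟩
      scale′ 𝟙 x                 ≡⟨ scale-one x ⟩
      x                          ∎
      where open ≡-Reasoning
    s⁻¹-witnesses : T (not (does (s⁻¹ ≟ 𝟘)) ∧ does (scale′ s⁻¹ z ≟ᵥ x))
    s⁻¹-witnesses = subst T (sym (cong₂ _∧_ (cong not (dec-false (s⁻¹ ≟ 𝟘) (inv≢0 s s≢0)))
                                             (dec-true (scale′ s⁻¹ z ≟ᵥ x) s⁻¹z≡x))) tt

  scaling-witness : ∀ (x z : Point) s → ¬ nonzeroᶠ s * ⟦ scale′ s x ≟ᵥ z ⟧ ≡ 0 → (¬ s ≡ 𝟘) × (scale′ s x ≡ z)
  scaling-witness x z s h =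
    ⟦⟧≢0⇒holds (¬? (s ≟ 𝟘)) (λ e → h (cong (_* ⟦ scale′ s x ≟ᵥ z ⟧) e)) ,
    ⟦⟧≢0⇒holds (scale′ s x ≟ᵥ z) (λ e → h (trans (cong (nonzeroᶠ s *_) e) (*-zeroʳ (nonzeroᶠ s))))

  scalings≤1 : ∀ x z → ¬ x ≡ 0ᵥ D → scalings x z ≤ 1
  scalings≤1 x z x≢0 = ∑ᶠ.∑-≤1 (λ s → nonzeroᶠ s * ⟦ scale′ s x ≟ᵥ z ⟧)
    (λ s → *-mono-≤ (⟦⟧-≤1 (¬? (s ≟ 𝟘))) (⟦⟧-≤1 (scale′ s x ≟ᵥ z)))
    (λ s t hs ht → scale-injectiveˡ s t x x≢0 (trans (proj₂ (scaling-witness x z s hs)) (sym (proj₂ (scaling-witness x z t ht)))))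

  𝟏E⁺≢0 : ∀ x → ¬ χ (E x) * ⟦ ¬? (x ≟ᵥ 0ᵥ D) ⟧ ≡ 0 → (E x ≡ true) × (¬ x ≡ 0ᵥ D)
  𝟏E⁺≢0 x h with E x | x ≟ᵥ 0ᵥ D
  ... | false | _       = ⊥-elim (h refl)
  ... | true  | yes _   = ⊥-elim (h refl)
  ... | true  | no x≢0 = refl , x≢0

  scalings-bound : ∀ x z → 𝟏E⁺ x * scalings x z ≤ nonzero z * χ (E x ∧ inLine 𝔽 z x)
  scalings-bound x z with 𝟏E⁺ x ≟ℕ 0 | scalings x z ≟ℕ 0
  ... | yes e | _     = ≤-trans (≤-reflexive (cong (_* scalings x z) e)) z≤n
  ... | no _  | yes e = ≤-trans (≤-reflexive (trans (cong (𝟏E⁺ x *_) e) (*-zeroʳ (𝟏E⁺ x)))) z≤n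
  ... | no e  | no e′ with 𝟏E⁺≢0 x e | ∑≢0⇒witness (allFin q) (λ s → nonzeroᶠ s * ⟦ scale′ s x ≟ᵥ z ⟧) e′
  ...   | Ex≡true , x≢0 | s , h = begin
    𝟏E⁺ x * scalings x z                  ≤⟨ *-mono-≤ (*-mono-≤ (χ-≤1 (E x)) (⟦⟧-≤1 (¬? (x ≟ᵥ 0ᵥ D)))) (scalings≤1 x z x≢0) ⟩
    1                                     ≡⟨ sym (cong₂ _*_ (⟦⟧-yes (¬? (z ≟ᵥ 0ᵥ D)) z≢0) (cong₂ (λ a b → χ (a ∧ b)) Ex≡true x∈l_z)) ⟩
    nonzero z * χ (E x ∧ inLine 𝔽 z x)    ∎
    where
    open ≤-Reasoning
    s≢0 = proj₁ (scaling-witness x z s h)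
    sx≡z = proj₂ (scaling-witness x z s h)
    z≢0 : ¬ z ≡ 0ᵥ D
    z≢0 z≡0 = x≢0 (scale≡0⇒≡0 s x s≢0 (trans sx≡z z≡0))
    x∈l_z : inLine 𝔽 z x ≡ true
    x∈l_z = inLine-scaled x z s s≢0 sx≡z

  lineWeight-bound : ∀ z → lineWeight z ≤ nonzero z * card 𝔽 (_∩line_ 𝔽 E z)
  lineWeight-bound z = ≤-trans (∑-mono (allPts 𝔽 D) (λ x → scalings-bound x z))
    (≤-reflexive (trans (∑-*ˡ (allPts 𝔽 D) (nonzero z) _) (cong (nonzero z *_) (sym (length-filter (allPts 𝔽 D) (_∩line_ 𝔽 E z))))))

  ∑ᶠ-nonzero : ∑ᶠ nonzeroᶠ + 1 ≡ q
  ∑ᶠ-nonzero = trans (∑ᶠ.∑-≢+1 𝟘) ∑ᶠ-one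

  ∑-nonzero : ∑ₚ nonzero + 1 ≡ Q
  ∑-nonzero = trans (∑ᵥ.∑-≢+1 D (0ᵥ D)) (∑ᵥ-one D)

  ∑nonzero-excess : ℕ
  ∑nonzero-excess = ∑ₚ (λ z → nonzero z * excess z)

  sparse-lines⇒ : ∀ N → (∀ z → ¬ z ≡ 0ᵥ D → 4 * (card 𝔽 (_∩line_ 𝔽 E z) * Q) ≤ N) →
                  4 * (Q * (∑ᶠ nonzeroᶠ * ∑E⁺-excess)) ≤ N * ∑nonzero-excess
  sparse-lines⇒ N sparse = begin
    4 * (Q * (∑ᶠ nonzeroᶠ * ∑E⁺-excess))                   ≡⟨ cong (λ a → 4 * (Q * a)) ∑E⁺-excess-by-lines ⟩
    4 * (Q * ∑ₚ (λ z → excess z * lineWeight z))           ≡⟨ distribute ⟩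
    ∑ₚ (λ z → excess z * (4 * (lineWeight z * Q)))         ≤⟨ ∑-mono (allPts 𝔽 D) (λ z → *-monoʳ-≤ (excess z) (pointwise z (z ≟ᵥ 0ᵥ D))) ⟩
    ∑ₚ (λ z → excess z * (nonzero z * N))                  ≡⟨ ∑-cong (allPts 𝔽 D) (λ z → regroup (excess z) (nonzero z) N) ⟩
    ∑ₚ (λ z → N * (nonzero z * excess z))                  ≡⟨ ∑-*ˡ (allPts 𝔽 D) N _ ⟩
    N * ∑nonzero-excess                                    ∎
    where
    open ≤-Reasoning
    regroup : ∀ a b c → a * (b * c) ≡ c * (b * a)
    regroup = solve-∀
    regroup′ : ∀ a b c d → a * (b * (c * d)) ≡ c * (a * (d * b))
    regroup′ = solve-∀
    distribute : 4 * (Q * ∑ₚ (λ z → excess z * lineWeight z)) ≡ ∑ₚ (λ z → excess z * (4 * (lineWeight z * Q)))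
    distribute = begin-equality
      4 * (Q * ∑ₚ (λ z → excess z * lineWeight z))       ≡⟨ cong (4 *_) (sym (∑-*ˡ (allPts 𝔽 D) Q _)) ⟩
      4 * ∑ₚ (λ z → Q * (excess z * lineWeight z))       ≡⟨ sym (∑-*ˡ (allPts 𝔽 D) 4 _) ⟩
      ∑ₚ (λ z → 4 * (Q * (excess z * lineWeight z)))     ≡⟨ ∑-cong (allPts 𝔽 D) (λ z → regroup′ 4 Q (excess z) (lineWeight z)) ⟩
      ∑ₚ (λ z → excess z * (4 * (lineWeight z * Q)))     ∎
    pointwise : ∀ z → Dec (z ≡ 0ᵥ D) → 4 * (lineWeight z * Q) ≤ nonzero z * N
    pointwise z (yes z≡0) = ≤-trans (≤-reflexive (cong (λ w → 4 * (w * Q)) no-weight)) z≤n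
      where
      no-weight : lineWeight z ≡ 0
      no-weight = n≤0⇒n≡0 (≤-trans (lineWeight-bound z)
                    (≤-reflexive (cong (_* card 𝔽 (_∩line_ 𝔽 E z)) (⟦⟧-no (¬? (z ≟ᵥ 0ᵥ D)) (λ z≢0 → z≢0 z≡0)))))
    pointwise z (no z≢0) = begin
      4 * (lineWeight z * Q)                            ≤⟨ *-monoʳ-≤ 4 (*-monoˡ-≤ Q (lineWeight-bound z)) ⟩
      4 * (nonzero z * card 𝔽 (_∩line_ 𝔽 E z) * Q)     ≡⟨ cong (λ n → 4 * (n * card 𝔽 (_∩line_ 𝔽 E z) * Q)) z-one ⟩
      4 * (1 * card 𝔽 (_∩line_ 𝔽 E z) * Q)           ≡⟨ cong (λ c → 4 * (c * Q)) (*-identityˡ (card 𝔽 (_∩line_ 𝔽 E z))) ⟩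
      4 * (card 𝔽 (_∩line_ 𝔽 E z) * Q)               ≤⟨ sparse z z≢0 ⟩
      N                                             ≡⟨ sym (*-identityˡ N) ⟩
      1 * N                                         ≡⟨ cong (_* N) (sym z-one) ⟩
      nonzero z * N                                 ∎
      where
      z-one : nonzero z ≡ 1
      z-one = ⟦⟧-yes (¬? (z ≟ᵥ 0ᵥ D)) z≢0

  ∑∑-cong : ∀ {g h : Point → Point → ℕ} → (∀ y y′ → g y y′ ≡ h y y′) → ∑∑ g ≡ ∑∑ h
  ∑∑-cong e = ∑-cong (allPts 𝔽 D) (λ y → ∑-cong (allPts 𝔽 D) (e y))

  ∑∑-distrib-+ : ∀ g h → ∑∑ (λ y y′ → g y y′ + h y y′) ≡ ∑∑ g + ∑∑ h
  ∑∑-distrib-+ g h = trans (∑-cong (allPts 𝔽 D) (λ y → ∑-distrib-+ (allPts 𝔽 D) (g y) (h y))) (∑-distrib-+ (allPts 𝔽 D) _ _)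

  ∑∑-*ˡ : ∀ c g → ∑∑ (λ y y′ → c * g y y′) ≡ c * ∑∑ g
  ∑∑-*ˡ c g = trans (∑-cong (allPts 𝔽 D) (λ y → ∑-*ˡ (allPts 𝔽 D) c (g y))) (∑-*ˡ (allPts 𝔽 D) c _)

  ∑∑-*ʳ : ∀ c g → ∑∑ (λ y y′ → g y y′ * c) ≡ ∑∑ g * c
  ∑∑-*ʳ c g = trans (∑∑-cong (λ y y′ → *-comm (g y y′) c)) (trans (∑∑-*ˡ c g) (*-comm c _))

  ∑∑-𝟏F² : ∑∑ (λ y y′ → 𝟏F y * 𝟏F y′) ≡ #F * #F
  ∑∑-𝟏F² = trans (∑-cong (allPts 𝔽 D) (λ y → ∑-*ˡ (allPts 𝔽 D) (𝟏F y) 𝟏F)) (∑-*ʳ (allPts 𝔽 D) #F 𝟏F)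

  ∑∑-𝟏F²-diagonal : ∑∑ (λ y y′ → 𝟏F y * 𝟏F y′ * ⟦ y ≟ᵥ y′ ⟧) ≡ #F
  ∑∑-𝟏F²-diagonal = ∑-cong (allPts 𝔽 D) (λ y →
    trans (∑-cong (allPts 𝔽 D) (λ y′ → *-comm (𝟏F y * 𝟏F y′) ⟦ y ≟ᵥ y′ ⟧))
          (trans (∑ᵥ.∑-delta′ D y (λ y′ → 𝟏F y * 𝟏F y′)) (χ-idem (F y))))

  agreements : Point → Point → ℕ
  agreements y y′ = ∑ₚ (λ z → ⟦ dot′ z y ≟ dot′ z y′ ⟧)

  -- Q points agree on y = y′, and a hyperplane of q^k = Q / q points otherwise.
  q*agreements : ∀ y y′ (d : Dec (y ≡ y′)) → q * agreements y y′ + ⟦ d ⟧ * Q ≡ Q + ⟦ d ⟧ * (q * Q)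
  q*agreements y .y (yes refl) = trans (cong (λ a → q * a + 1 * Q) everywhere) (regroup q Q)
    where
    everywhere : agreements y y ≡ Q
    everywhere = trans (∑-cong (allPts 𝔽 D) (λ z → ⟦⟧-yes (dot′ z y ≟ dot′ z y) refl)) (∑ᵥ-one D)
    regroup : ∀ q Q → q * Q + 1 * Q ≡ Q + 1 * (q * Q)
    regroup = solve-∀
  q*agreements y y′ (no y≢y′) = cong (λ a → q * a + 0) hyperplane
    where
    hyperplane : agreements y y′ ≡ q ^ k
    hyperplane = trans (∑-cong (allPts 𝔽 D) (λ z → ⟦⟧-cong (dot′ z y ≟ dot′ z y′) (dot′ z (y -ᵥ y′) ≟ 𝟘)
                                                     (λ e → trans (dot--ᵥ z y y′) (x≈y⇒x∙y⁻¹≈ε e))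
                                                     (λ e → x∙y⁻¹≈ε⇒x≈y _ _ (trans (sym (dot--ᵥ z y y′)) e))))
                       (hyperplane-size k (y -ᵥ y′) (λ e → y≢y′ (-ᵥ≡0⇒≡ y y′ e)) 𝟘)

  ∑-collisions : ∑ₚ collisions ≡ ∑∑ (λ y y′ → 𝟏F y * 𝟏F y′ * agreements y y′)
  ∑-collisions =
    trans (∑-swap (allPts 𝔽 D) (allPts 𝔽 D) (λ z y → ∑ₚ (λ y′ → 𝟏F y * 𝟏F y′ * ⟦ dot′ z y ≟ dot′ z y′ ⟧)))
          (∑-cong (allPts 𝔽 D) (λ y → trans (∑-swap (allPts 𝔽 D) (allPts 𝔽 D) (λ z y′ → 𝟏F y * 𝟏F y′ * ⟦ dot′ z y ≟ dot′ z y′ ⟧))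
                                           (∑-cong (allPts 𝔽 D) (λ y′ → ∑-*ˡ (allPts 𝔽 D) (𝟏F y * 𝟏F y′) _))))

  q*∑-collisions : q * ∑ₚ collisions + #F * Q ≡ (#F * #F) * Q + #F * (q * Q)
  q*∑-collisions = begin
    q * ∑ₚ collisions + #F * Q
      ≡⟨ cong₂ _+_ (trans (cong (q *_) ∑-collisions) (sym (∑∑-*ˡ q _))) (trans (cong (_* Q) (sym ∑∑-𝟏F²-diagonal)) (sym (∑∑-*ʳ Q _))) ⟩
    ∑∑ (λ y y′ → q * (W y y′ * agreements y y′)) + ∑∑ (λ y y′ → W y y′ * δ y y′ * Q)
      ≡⟨ sym (∑∑-distrib-+ _ _) ⟩
    ∑∑ (λ y y′ → q * (W y y′ * agreements y y′) + W y y′ * δ y y′ * Q)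
      ≡⟨ ∑∑-cong pointwise ⟩
    ∑∑ (λ y y′ → W y y′ * Q + W y y′ * δ y y′ * (q * Q))
      ≡⟨ ∑∑-distrib-+ _ _ ⟩
    ∑∑ (λ y y′ → W y y′ * Q) + ∑∑ (λ y y′ → W y y′ * δ y y′ * (q * Q))
      ≡⟨ cong₂ _+_ (trans (∑∑-*ʳ Q W) (cong (_* Q) ∑∑-𝟏F²)) (trans (∑∑-*ʳ (q * Q) _) (cong (_* (q * Q)) ∑∑-𝟏F²-diagonal)) ⟩
    (#F * #F) * Q + #F * (q * Q) ∎
    where
    open ≡-Reasoning
    W δ : Point → Point → ℕ
    W y y′ = 𝟏F y * 𝟏F y′
    δ y y′ = ⟦ y ≟ᵥ y′ ⟧
    factor : ∀ q W c δ Q → q * (W * c) + W * δ * Q ≡ W * (q * c + δ * Q)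
    factor = solve-∀
    expand : ∀ W Q δ q → W * (Q + δ * (q * Q)) ≡ W * Q + W * δ * (q * Q)
    expand = solve-∀
    pointwise : ∀ y y′ → q * (W y y′ * agreements y y′) + W y y′ * δ y y′ * Q ≡ W y y′ * Q + W y y′ * δ y y′ * (q * Q)
    pointwise y y′ = trans (factor q (W y y′) (agreements y y′) (δ y y′) Q)
                           (trans (cong (W y y′ *_) (q*agreements y y′ (y ≟ᵥ y′))) (expand (W y y′) Q (δ y y′) q))

  collisions-at-0 : collisions (0ᵥ D) ≡ #F * #F
  collisions-at-0 = trans (∑∑-cong (λ y y′ → trans (cong (𝟏F y * 𝟏F y′ *_) (⟦⟧-yes (dot′ (0ᵥ D) y ≟ dot′ (0ᵥ D) y′) (trans (dot-zeroˡ y) (sym (dot-zeroˡ y′)))))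
                                                  (*-identityʳ (𝟏F y * 𝟏F y′))))
                          ∑∑-𝟏F²

  ∑-collisions-split : ∑ₚ collisions ≡ ∑ₚ (λ z → nonzero z * collisions z) + #F * #F
  ∑-collisions-split = begin
    ∑ₚ collisions                                           ≡⟨ ∑-cong (allPts 𝔽 D) (λ z → sym (trans (cong (_* collisions z) (⟦¬⟧+⟦⟧≡1 (z ≟ᵥ 0ᵥ D))) (*-identityˡ (collisions z)))) ⟩
    ∑ₚ (λ z → (nonzero z + ⟦ z ≟ᵥ 0ᵥ D ⟧) * collisions z)    ≡⟨ ∑-cong (allPts 𝔽 D) (λ z → *-distribʳ-+ (collisions z) (nonzero z) _) ⟩
    ∑ₚ (λ z → nonzero z * collisions z + ⟦ z ≟ᵥ 0ᵥ D ⟧ * collisions z) ≡⟨ ∑-distrib-+ (allPts 𝔽 D) _ _ ⟩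
    ∑ₚ (λ z → nonzero z * collisions z) + ∑ₚ (λ z → ⟦ z ≟ᵥ 0ᵥ D ⟧ * collisions z)
      ≡⟨ cong (∑ₚ (λ z → nonzero z * collisions z) +_) (trans (∑ᵥ.∑-delta D (0ᵥ D) collisions) collisions-at-0) ⟩
    ∑ₚ (λ z → nonzero z * collisions z) + #F * #F           ∎
    where open ≡-Reasoning

  q*∑nonzero-collisions : q * ∑ₚ (λ z → nonzero z * collisions z) ≡ ∑nonzero-excess + ∑ₚ nonzero * (#F * #F)
  q*∑nonzero-collisions = begin
    q * ∑ₚ (λ z → nonzero z * collisions z)                      ≡⟨ sym (∑-*ˡ (allPts 𝔽 D) q _) ⟩
    ∑ₚ (λ z → q * (nonzero z * collisions z))                    ≡⟨ ∑-cong (allPts 𝔽 D) split ⟩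
    ∑ₚ (λ z → nonzero z * excess z + nonzero z * (#F * #F))       ≡⟨ ∑-distrib-+ (allPts 𝔽 D) _ _ ⟩
    ∑nonzero-excess + ∑ₚ (λ z → nonzero z * (#F * #F))            ≡⟨ cong (∑nonzero-excess +_) (∑-*ʳ (allPts 𝔽 D) (#F * #F) nonzero) ⟩
    ∑nonzero-excess + ∑ₚ nonzero * (#F * #F)                      ∎
    where
    open ≡-Reasoning
    swap : ∀ q a b → q * (a * b) ≡ a * (q * b)
    swap = solve-∀
    split : ∀ z → q * (nonzero z * collisions z) ≡ nonzero z * excess z + nonzero z * (#F * #F)
    split z = trans (swap q (nonzero z) (collisions z))
                    (trans (cong (nonzero z *_) (trans (q*collisions≡ z) (+-comm (#F * #F) (excess z))))
                           (*-distribˡ-+ (nonzero z) (excess z) (#F * #F)))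

  #E≤#E⁺+1 : #E ≤ #E⁺ + 1
  #E≤#E⁺+1 = ≤-trans (∑-mono (allPts 𝔽 D) split)
                     (≤-reflexive (trans (∑-distrib-+ (allPts 𝔽 D) 𝟏E⁺ _) (cong (#E⁺ +_) (allPts-enumerates D (0ᵥ D)))))
    where
    split : ∀ x → 𝟏E x ≤ 𝟏E⁺ x + ⟦ x ≟ᵥ 0ᵥ D ⟧
    split x = begin
      𝟏E x                                         ≡⟨ sym (*-identityʳ (𝟏E x)) ⟩
      𝟏E x * 1                                     ≡⟨ cong (𝟏E x *_) (sym (⟦¬⟧+⟦⟧≡1 (x ≟ᵥ 0ᵥ D))) ⟩
      𝟏E x * (nonzero x + ⟦ x ≟ᵥ 0ᵥ D ⟧)           ≡⟨ *-distribˡ-+ (𝟏E x) (nonzero x) _ ⟩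
      𝟏E⁺ x + 𝟏E x * ⟦ x ≟ᵥ 0ᵥ D ⟧                 ≤⟨ +-monoʳ-≤ (𝟏E⁺ x) (≤-trans (*-monoˡ-≤ _ (χ-≤1 (E x))) (≤-reflexive (*-identityˡ _))) ⟩
      𝟏E⁺ x + ⟦ x ≟ᵥ 0ᵥ D ⟧                        ∎
      where open ≤-Reasoning

  #F≤Q : #F ≤ Q
  #F≤Q = ≤-trans (∑-mono (allPts 𝔽 D) (λ y → χ-≤1 (F y))) (≤-reflexive (∑ᵥ-one D))

  product-set-size : 4 * Q ≤ card 𝔽 E * card 𝔽 F →
    (∀ z → ¬ z ≡ 0ᵥ D → 4 * (card 𝔽 (_∩line_ 𝔽 E z) * Q) ≤ card 𝔽 E * card 𝔽 F) →
    q ≤ 2 * cardΠ 𝔽 E F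
  product-set-size 4Q≤N sparse =
    product-set-bound q #E⁺ #F ∑E⁺-excess N _ _ (cardΠ 𝔽 E F)
      #E⁺#F²≤|Π|*∑representations² ∑-representations² q*∑E⁺-collisions 4A≤Nf
      (size-bound N #E #E⁺ #F Q N≡#E#F #E≤#E⁺+1 4Q≤N #F≤Q) (≤-trans 1≤4Q 4Q≤N)
    where
    N = card 𝔽 E * card 𝔽 F
    N≡#E#F : N ≡ #E * #F
    N≡#E#F = cong₂ _*_ (length-filter (allPts 𝔽 D) E) (length-filter (allPts 𝔽 D) F)
    1≤q : 1 ≤ q
    1≤q = ≤-trans (s≤s z≤n) 2≤q
    1≤Q : 1 ≤ Q
    1≤Q = subst (_≤ Q) (^-zeroˡ D) (^-monoˡ-≤ D 1≤q)
    1≤4Q : 1 ≤ 4 * Q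
    1≤4Q = ≤-trans 1≤Q (m≤n*m Q 4)
    1≤r : 1 ≤ ∑ᶠ nonzeroᶠ
    1≤r = +-cancelʳ-≤ 1 1 _ (≤-trans 2≤q (≤-reflexive (sym ∑ᶠ-nonzero)))
    total : ∑nonzero-excess + #F * Q ≤ q * (#F * Q)
    total = excess-sum-bound q #F ∑nonzero-excess (∑ₚ collisions) _ (∑ₚ nonzero) Q
              q*∑-collisions ∑-collisions-split q*∑nonzero-collisions ∑-nonzero 1≤q
    4A≤Nf : 4 * ∑E⁺-excess ≤ N * #F
    4A≤Nf = excess-bound q (∑ᶠ nonzeroᶠ) Q N ∑nonzero-excess ∑E⁺-excess #F ∑ᶠ-nonzero 1≤r 1≤Q (sparse-lines⇒ N sparse) total

module RationalBounds where
  open import Data.Nat as ℕ using (ℕ; zero; suc)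
  open import Data.Integer as ℤ using (+_)
  import Data.Integer.Properties as ℤ
  open import Data.Rational
  open import Data.Rational.Properties
  open import Data.Nat.Coprimality using (1-coprimeTo) renaming (sym to coprime-sym)
  open import Data.Empty using (⊥-elim)
  open import Relation.Nullary using (yes; no)
  open import Relation.Binary.PropositionalEquality using (_≡_; refl; cong; cong₂; subst; subst₂; trans) renaming (sym to ≡-sym)
  open import Algebra.Bundles using (CommutativeRing)
  open import Algebra.Properties.CommutativeSemiring.Exp (CommutativeRing.commutativeSemiring +-*-commutativeRing)
    using (^-distrib-*)
  open import Algebra.Properties.Semiring.Exp (CommutativeRing.semiring +-*-commutativeRing)
    using (_^_; ^-homo-*; ^-assocʳ)

  ℕ→ℚ≡mkℚ : ∀ n → ℕ→ℚ n ≡ mkℚ (+ n) 0 (coprime-sym (1-coprimeTo n))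
  ℕ→ℚ≡mkℚ n = normalize-coprime (coprime-sym (1-coprimeTo n))

  ℕ→ℚ-* : ∀ m n → ℕ→ℚ m * ℕ→ℚ n ≡ ℕ→ℚ (m ℕ.* n)
  ℕ→ℚ-* m n rewrite ℕ→ℚ≡mkℚ m | ℕ→ℚ≡mkℚ n = cong (_/ 1) (≡-sym (ℤ.pos-* m n))

  ℕ→ℚ-cancel-≤ : ∀ {m n} → ℕ→ℚ m ≤ ℕ→ℚ n → m ℕ.≤ n
  ℕ→ℚ-cancel-≤ {m} {n} h rewrite ℕ→ℚ≡mkℚ m | ℕ→ℚ≡mkℚ n with h
  ... | *≤* m≤n rewrite ℤ.*-identityʳ (+ m) | ℤ.*-identityʳ (+ n) = ℤ.drop‿+≤+ m≤n

  ℕ→ℚ-mono-≤ : ∀ {m n} → m ℕ.≤ n → ℕ→ℚ m ≤ ℕ→ℚ n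
  ℕ→ℚ-mono-≤ {m} {n} m≤n rewrite ℕ→ℚ≡mkℚ m | ℕ→ℚ≡mkℚ n =
    *≤* (subst₂ ℤ._≤_ (≡-sym (ℤ.*-identityʳ (+ m))) (≡-sym (ℤ.*-identityʳ (+ n))) (ℤ.+≤+ m≤n))

  0≤ℕ→ℚ : ∀ n → 0ℚ ≤ ℕ→ℚ n
  0≤ℕ→ℚ n = ℕ→ℚ-mono-≤ {0} {n} ℕ.z≤n

  ^ℚ≡^ : ∀ x n → x ^ℚ n ≡ x ^ n
  ^ℚ≡^ x zero    = refl
  ^ℚ≡^ x (suc n) = cong (x *_) (^ℚ≡^ x n)

  ℕ→ℚ-^ : ∀ n k → ℕ→ℚ (n ℕ.^ k) ≡ ℕ→ℚ n ^ℚ k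
  ℕ→ℚ-^ n zero    = refl
  ℕ→ℚ-^ n (suc k) = trans (≡-sym (ℕ→ℚ-* n (n ℕ.^ k))) (cong (ℕ→ℚ n *_) (ℕ→ℚ-^ n k))

  ^ℚ-distrib-* : ∀ x y n → (x * y) ^ℚ n ≡ x ^ℚ n * y ^ℚ n
  ^ℚ-distrib-* x y n = trans (^ℚ≡^ (x * y) n)
    (trans (^-distrib-* x y n) (≡-sym (cong₂ _*_ (^ℚ≡^ x n) (^ℚ≡^ y n))))

  ^ℚ-+ : ∀ x m n → x ^ℚ (m ℕ.+ n) ≡ x ^ℚ m * x ^ℚ n
  ^ℚ-+ x m n = trans (^ℚ≡^ x (m ℕ.+ n)) (trans (^-homo-* x m n) (≡-sym (cong₂ _*_ (^ℚ≡^ x m) (^ℚ≡^ x n))))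

  ^ℚ-* : ∀ x m n → x ^ℚ (m ℕ.* n) ≡ (x ^ℚ m) ^ℚ n
  ^ℚ-* x m n = trans (^ℚ≡^ x (m ℕ.* n)) (trans (≡-sym (^-assocʳ x m n))
                 (≡-sym (trans (^ℚ≡^ (x ^ℚ m) n) (cong (_^ n) (^ℚ≡^ x m)))))

  ^ℚ-nonNeg : ∀ {x} n → 0ℚ ≤ x → 0ℚ ≤ x ^ℚ n
  ^ℚ-nonNeg zero    0≤x = *≤* (ℤ.+≤+ ℕ.z≤n)
  ^ℚ-nonNeg {x} (suc n) 0≤x = nonNegative⁻¹ _ {{nonNeg*nonNeg⇒nonNeg x {{nonNegative 0≤x}} (x ^ℚ n) {{nonNegative (^ℚ-nonNeg n 0≤x)}}}}

  *-mono-≤-nonNeg : ∀ {a b c d} → 0ℚ ≤ a → 0ℚ ≤ c → a ≤ b → c ≤ d → a * c ≤ b * d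
  *-mono-≤-nonNeg {a} {b} {c} {d} 0≤a 0≤c a≤b c≤d = begin
    a * c ≤⟨ *-monoʳ-≤-nonNeg c {{nonNegative 0≤c}} a≤b ⟩
    b * c ≤⟨ *-monoˡ-≤-nonNeg b {{nonNegative (≤-trans 0≤a a≤b)}} c≤d ⟩
    b * d ∎
    where open ≤-Reasoning

  ^ℚ-mono-≤ : ∀ {x y} n → 0ℚ ≤ x → x ≤ y → x ^ℚ n ≤ y ^ℚ n
  ^ℚ-mono-≤ zero    0≤x x≤y = ≤-refl
  ^ℚ-mono-≤ (suc n) 0≤x x≤y = *-mono-≤-nonNeg 0≤x (^ℚ-nonNeg n 0≤x) x≤y (^ℚ-mono-≤ n 0≤x x≤y)

  ^ℚ-mono-< : ∀ {x y} n → 0ℚ ≤ x → x < y → x ^ℚ suc n < y ^ℚ suc n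
  ^ℚ-mono-< {x} {y} n 0≤x x<y = begin-strict
    x * x ^ℚ n ≤⟨ *-monoˡ-≤-nonNeg x {{nonNegative 0≤x}} (^ℚ-mono-≤ n 0≤x (<⇒≤ x<y)) ⟩
    x * y ^ℚ n <⟨ *-monoˡ-<-pos (y ^ℚ n) {{positive (0<y^ n)}} x<y ⟩
    y * y ^ℚ n ∎
    where
    open ≤-Reasoning
    0<y : 0ℚ < y
    0<y = ≤-<-trans 0≤x x<y
    0<y^ : ∀ n → 0ℚ < y ^ℚ n
    0<y^ zero    = *<* (ℤ.+<+ (ℕ.s≤s ℕ.z≤n))
    0<y^ (suc n) = subst (_< y * y ^ℚ n) (*-zeroˡ (y ^ℚ n)) (*-monoˡ-<-pos (y ^ℚ n) {{positive (0<y^ n)}} 0<y)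

  ^ℚ-cancel-≤ : ∀ {x y} n .{{_ : ℕ.NonZero n}} → 0ℚ ≤ y → x ^ℚ n ≤ y ^ℚ n → x ≤ y
  ^ℚ-cancel-≤ {x} {y} (suc n) 0≤y xⁿ≤yⁿ with x ≤? y
  ... | yes x≤y = x≤y
  ... | no x≰y  = ⊥-elim (<-irrefl refl (≤-<-trans xⁿ≤yⁿ (^ℚ-mono-< n 0≤y (≰⇒> x≰y))))

  1≤^ℚ : ∀ {x} n → 1ℚ ≤ x → 1ℚ ≤ x ^ℚ n
  1≤^ℚ {x} n 1≤x = subst (_≤ x ^ℚ n) (1^ℚ n) (^ℚ-mono-≤ n (*≤* (ℤ.+≤+ ℕ.z≤n)) 1≤x)
    where
    1^ℚ : ∀ n → 1ℚ ^ℚ n ≡ 1ℚ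
    1^ℚ zero    = refl
    1^ℚ (suc n) = trans (*-identityˡ _) (1^ℚ n)

  0<½ : 0ℚ < ½
  0<½ = *<* (ℤ.+<+ (ℕ.s≤s ℕ.z≤n))

  ½<1 : ½ < 1ℚ
  ½<1 = *<* (ℤ.+<+ (ℕ.s≤s (ℕ.s≤s ℕ.z≤n)))

  ½*≤ : ∀ m n → m ℕ.≤ 2 ℕ.* n → ½ * ℕ→ℚ m ≤ ℕ→ℚ n
  ½*≤ m n m≤2n = begin
    ½ * ℕ→ℚ m               ≤⟨ *-monoˡ-≤-nonNeg ½ (ℕ→ℚ-mono-≤ m≤2n) ⟩
    ½ * ℕ→ℚ (2 ℕ.* n)       ≡⟨ cong (½ *_) (≡-sym (ℕ→ℚ-* 2 n)) ⟩
    ½ * (ℕ→ℚ 2 * ℕ→ℚ n)     ≡⟨ ≡-sym (*-assoc ½ (ℕ→ℚ 2) (ℕ→ℚ n)) ⟩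
    (½ * ℕ→ℚ 2) * ℕ→ℚ n     ≡⟨ *-identityˡ (ℕ→ℚ n) ⟩
    ℕ→ℚ n                   ∎
    where open ≤-Reasoning

  module SizeConstant (C₀ : ℚ) (0<C₀ : 0ℚ < C₀) where

    K C : ℚ
    K = C₀ + 1ℚ
    C = ℕ→ℚ 4 * K

    1≤K : 1ℚ ≤ K
    1≤K = subst (_≤ K) (+-identityˡ 1ℚ) (+-mono-≤ (<⇒≤ 0<C₀) ≤-refl)

    0<K : 0ℚ < K
    0<K = <-≤-trans (*<* (ℤ.+<+ (ℕ.s≤s ℕ.z≤n))) 1≤K

    C₀≤K : C₀ ≤ K
    C₀≤K = subst (_≤ K) (+-identityʳ C₀) (+-mono-≤ (≤-refl {C₀}) (*≤* (ℤ.+≤+ ℕ.z≤n)))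

    0≤C : 0ℚ ≤ C
    0≤C = nonNegative⁻¹ C {{nonNeg*nonNeg⇒nonNeg (ℕ→ℚ 4) {{nonNegative (0≤ℕ→ℚ 4)}} K {{nonNegative (<⇒≤ 0<K)}}}}

    4≤C : ℕ→ℚ 4 ≤ C
    4≤C = subst (_≤ C) (*-identityʳ (ℕ→ℚ 4)) (*-monoˡ-≤-nonNeg (ℕ→ℚ 4) {{nonNegative (0≤ℕ→ℚ 4)}} 1≤K)

    1<C : 1ℚ < C
    1<C = <-≤-trans (*<* (ℤ.+<+ (ℕ.s≤s (ℕ.s≤s ℕ.z≤n)))) 4≤C

    module _ (d a b : ℕ) .{{_ : ℕ.NonZero b}} (q N : ℕ) (1≤q : 1 ℕ.≤ q)
             (large : C ^ℚ b * ℕ→ℚ q ^ℚ (d ℕ.* b ℕ.+ a) ≤ ℕ→ℚ N ^ℚ b) where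

      private
        Q = ℕ→ℚ q
        0≤Q^ : ∀ n → 0ℚ ≤ Q ^ℚ n
        0≤Q^ n = ^ℚ-nonNeg n (0≤ℕ→ℚ q)
        Q^db≡ : (Q ^ℚ d) ^ℚ b * Q ^ℚ a ≡ Q ^ℚ (d ℕ.* b ℕ.+ a)
        Q^db≡ = trans (cong (_* Q ^ℚ a) (≡-sym (^ℚ-* Q d b))) (≡-sym (^ℚ-+ Q (d ℕ.* b) a))

      4q^d≤N : 4 ℕ.* q ℕ.^ d ℕ.≤ N
      4q^d≤N = ℕ→ℚ-cancel-≤ (begin
        ℕ→ℚ (4 ℕ.* q ℕ.^ d)     ≡⟨ ≡-sym (ℕ→ℚ-* 4 (q ℕ.^ d)) ⟩
        ℕ→ℚ 4 * ℕ→ℚ (q ℕ.^ d)   ≡⟨ cong (ℕ→ℚ 4 *_) (ℕ→ℚ-^ q d) ⟩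
        ℕ→ℚ 4 * Q ^ℚ d          ≤⟨ *-monoʳ-≤-nonNeg (Q ^ℚ d) {{nonNegative (0≤Q^ d)}} 4≤C ⟩
        C * Q ^ℚ d              ≤⟨ ^ℚ-cancel-≤ b (0≤ℕ→ℚ N) (≤-trans [CQ^d]^b≤ large) ⟩
        ℕ→ℚ N                   ∎)
        where
        open ≤-Reasoning
        [CQ^d]^b≤ : (C * Q ^ℚ d) ^ℚ b ≤ C ^ℚ b * Q ^ℚ (d ℕ.* b ℕ.+ a)
        [CQ^d]^b≤ = begin
          (C * Q ^ℚ d) ^ℚ b              ≡⟨ ^ℚ-distrib-* C (Q ^ℚ d) b ⟩
          C ^ℚ b * (Q ^ℚ d) ^ℚ b         ≡⟨ cong (C ^ℚ b *_) (≡-sym (*-identityʳ _)) ⟩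
          C ^ℚ b * ((Q ^ℚ d) ^ℚ b * 1ℚ)  ≤⟨ *-monoˡ-≤-nonNeg (C ^ℚ b) {{nonNegative (^ℚ-nonNeg b 0≤C)}}
                                              (*-monoˡ-≤-nonNeg ((Q ^ℚ d) ^ℚ b) {{nonNegative (^ℚ-nonNeg b (0≤Q^ d))}}
                                                (1≤^ℚ a (ℕ→ℚ-mono-≤ 1≤q))) ⟩
          C ^ℚ b * ((Q ^ℚ d) ^ℚ b * Q ^ℚ a) ≡⟨ cong (C ^ℚ b *_) Q^db≡ ⟩
          C ^ℚ b * Q ^ℚ (d ℕ.* b ℕ.+ a)  ∎

      4Lq^d≤N : ∀ L → ℕ→ℚ L ^ℚ b ≤ C₀ ^ℚ b * Q ^ℚ a → 4 ℕ.* (L ℕ.* q ℕ.^ d) ℕ.≤ N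
      4Lq^d≤N L sparse = ℕ→ℚ-cancel-≤ (*-cancelˡ-≤-pos K {{positive 0<K}} (begin
        K * ℕ→ℚ (4 ℕ.* (L ℕ.* q ℕ.^ d))  ≡⟨ cong (K *_) cast ⟩
        K * (ℕ→ℚ 4 * (ℕ→ℚ L * Q ^ℚ d))   ≡⟨ ≡-sym (*-assoc K _ _) ⟩
        (K * ℕ→ℚ 4) * (ℕ→ℚ L * Q ^ℚ d)   ≡⟨ cong (_* (ℕ→ℚ L * Q ^ℚ d)) (*-comm K (ℕ→ℚ 4)) ⟩
        C * (ℕ→ℚ L * Q ^ℚ d)             ≤⟨ ^ℚ-cancel-≤ b C₀N≥0 [CLQ^d]^b≤ ⟩
        C₀ * ℕ→ℚ N                       ≤⟨ *-monoʳ-≤-nonNeg (ℕ→ℚ N) {{nonNegative (0≤ℕ→ℚ N)}} C₀≤K ⟩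
        K * ℕ→ℚ N                        ∎))
        where
        open ≤-Reasoning
        cast : ℕ→ℚ (4 ℕ.* (L ℕ.* q ℕ.^ d)) ≡ ℕ→ℚ 4 * (ℕ→ℚ L * Q ^ℚ d)
        cast = trans (≡-sym (ℕ→ℚ-* 4 (L ℕ.* q ℕ.^ d)))
                     (cong (ℕ→ℚ 4 *_) (trans (≡-sym (ℕ→ℚ-* L (q ℕ.^ d))) (cong (ℕ→ℚ L *_) (ℕ→ℚ-^ q d))))
        C₀N≥0 : 0ℚ ≤ C₀ * ℕ→ℚ N
        C₀N≥0 = nonNegative⁻¹ _ {{nonNeg*nonNeg⇒nonNeg C₀ {{nonNegative (<⇒≤ 0<C₀)}} (ℕ→ℚ N) {{nonNegative (0≤ℕ→ℚ N)}}}}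
        Cᵇ = C ^ℚ b
        C₀ᵇ = C₀ ^ℚ b
        swap : ∀ x y z → x * (y * z) ≡ y * (x * z)
        swap x y z = trans (≡-sym (*-assoc x y z)) (trans (cong (_* z) (*-comm x y)) (*-assoc y x z))
        [CLQ^d]^b≤ : (C * (ℕ→ℚ L * Q ^ℚ d)) ^ℚ b ≤ (C₀ * ℕ→ℚ N) ^ℚ b
        [CLQ^d]^b≤ = begin
          (C * (ℕ→ℚ L * Q ^ℚ d)) ^ℚ b                ≡⟨ trans (^ℚ-distrib-* C _ b) (cong (Cᵇ *_) (^ℚ-distrib-* (ℕ→ℚ L) (Q ^ℚ d) b)) ⟩
          Cᵇ * (ℕ→ℚ L ^ℚ b * (Q ^ℚ d) ^ℚ b)          ≤⟨ *-monoˡ-≤-nonNeg Cᵇ {{nonNegative (^ℚ-nonNeg b 0≤C)}}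
                                                        (*-monoʳ-≤-nonNeg ((Q ^ℚ d) ^ℚ b) {{nonNegative (^ℚ-nonNeg b (0≤Q^ d))}} sparse) ⟩
          Cᵇ * ((C₀ᵇ * Q ^ℚ a) * (Q ^ℚ d) ^ℚ b)      ≡⟨ cong (Cᵇ *_) (trans (*-assoc C₀ᵇ _ _) (cong (C₀ᵇ *_) (*-comm (Q ^ℚ a) _))) ⟩
          Cᵇ * (C₀ᵇ * ((Q ^ℚ d) ^ℚ b * Q ^ℚ a))      ≡⟨ swap Cᵇ C₀ᵇ _ ⟩
          C₀ᵇ * (Cᵇ * ((Q ^ℚ d) ^ℚ b * Q ^ℚ a))      ≡⟨ cong (λ z → C₀ᵇ * (Cᵇ * z)) Q^db≡ ⟩
          C₀ᵇ * (Cᵇ * Q ^ℚ (d ℕ.* b ℕ.+ a))          ≤⟨ *-monoˡ-≤-nonNeg C₀ᵇ {{nonNegative (^ℚ-nonNeg b (<⇒≤ 0<C₀))}} large ⟩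
          C₀ᵇ * ℕ→ℚ N ^ℚ b                            ≡⟨ ≡-sym (^ℚ-distrib-* C₀ _ b) ⟩
          (C₀ * ℕ→ℚ N) ^ℚ b                          ∎

open import Data.Nat using (ℕ; _≤_; _+_; NonZero)
open import Data.Nat as ℕ using ()
open import Data.Bool using (Bool)
open import Data.Fin using (Fin)
open import Data.Product using (∃; ∃₂; _×_)
open import Data.Rational using (ℚ; 0ℚ; 1ℚ; _<_; _*_) renaming (_≤_ to _≤ℚ_)
open import Relation.Nullary using (¬_)
open import Relation.Binary.PropositionalEquality using (_≡_)

open import Data.Product using (_,_)
open import Data.Rational using (½)
import Data.Nat.Properties as ℕP
open RationalBounds using (module SizeConstant; 0<½; ½<1; ½*≤)

lemma2p3 : (d : ℕ) → 2 ≤ d → (C₀ : ℚ) → 0ℚ < C₀ →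
    ∃₂ λ (C c : ℚ) → (1ℚ < C) × (0ℚ < c) × (c < 1ℚ) ×
      ((a b : ℕ) → .{{_ : NonZero b}} → a ≤ b →
       (q : ℕ) → (𝔽 : FiniteField q) → CharGt2 𝔽 →
       (E F : Pt 𝔽 d → Bool) →
       ((x : Pt 𝔽 d) → ¬ (x ≡ zeroPt 𝔽 d) →
          ℕ→ℚ (card 𝔽 (_∩line_ 𝔽 E x)) ^ℚ b ≤ℚ (C₀ ^ℚ b) * (ℕ→ℚ q ^ℚ a)) →
       (C ^ℚ b) * (ℕ→ℚ q ^ℚ ((d ℕ.* b) + a)) ≤ℚ ℕ→ℚ (card 𝔽 E ℕ.* card 𝔽 F) ^ℚ b →
       c * ℕ→ℚ q ≤ℚ ℕ→ℚ (cardΠ 𝔽 E F))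
lemma2p3 d@(ℕ.suc k) _ C₀ 0<C₀ = C , ½ , 1<C , 0<½ , ½<1 , λ a b _ q 𝔽 _ E F sparse large →
  let N = card 𝔽 E ℕ.* card 𝔽 F
      1≤q = ℕP.≤-trans (ℕ.s≤s ℕ.z≤n) (FieldAlgebra.2≤q 𝔽)
  in ½*≤ q (cardΠ 𝔽 E F) (ProductSetBound.product-set-size 𝔽 k E F
       (4q^d≤N d a b q N 1≤q large)
       (λ z z≢0 → 4Lq^d≤N d a b q N 1≤q large (card 𝔽 (_∩line_ 𝔽 E z)) (sparse z z≢0)))
  where open SizeConstant C₀ 0<C₀
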